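{- Let $\Gamma$ be a connected non-bipartite graph and $m\ge 3$. Then the tensor product $\Gamma\times K_m$ is $1/2$-RA or RA, and it is $1/2$-RA if and only if $m$ is even, $\deg v$ is odd for every $v\in\Gamma$, and $|N[u]\cap N[v]|$ is even for all $u,v\in\Gamma$.
   Context: All graphs are finite and simple; $K_m$ is the complete graph. The tensor product $\Gamma\times\Lambda$ has vertex set $V(\Gamma)\times V(\Lambda)$, with $(u_1,u_2)$ adjacent to $(v_1,v_2)$ iff $u_1$ is adjacent to $v_1$ and $u_2$ is adjacent to $v_2$. $N[v]$ is the closed neighbourhood of $v$; for a vertex set $S$, $\vec S$ is its $0/1$ indicator vector. The RA matrix $C_\Delta$ of a graph $\Delta$ on $n$ vertices has $n$ columns and rows $\vec{N[v]}$ for all vertices $v$ together with $\overrightarrow{N[u]\cap N[v]}$ for all pairs $u,v$. For $k\ge1$, $\Delta$ is $1/k$-RA if for every ordering of the columns of $C_\Delta$, the diagonal of the Hermite normal form of $C_\Delta$ is $(1,\dots,1,k)$ ($n-1$ ones). For a group $G$, $G^\Delta\le G^n$ is generated by the elements $g^v$ having $g$ at coordinates of $N[v]$ and identity elsewhere; $\Delta$ is RA if $[G,G]^n\le G^\Delta$ for all groups $G$. It is known that $\Delta$ is RA iff the $\mathbb{Z}$-row span of $C_\Delta$ is $\mathbb{Z}^n$, i.e. iff $\Delta$ is $1/1$-RA. -}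

module Defs where

open import Data.Nat as ℕ using (ℕ; zero; suc; _≡ᵇ_)
open import Data.Integer as ℤ using (ℤ; +_; _+_; _*_; _<_; _≤_)
open import Data.Fin using (Fin; zero; suc; toℕ; remQuot)
open import Data.Fin.Properties using () renaming (_≟_ to _≟ᶠ_)
open import Data.Fin.Permutation using (Permutation′; _⟨$⟩ʳ_)
open import Data.Bool using (Bool; true; false; _∧_; _∨_; not; if_then_else_)
open import Data.Product using (Σ; ∃; _×_; _,_; proj₁; proj₂)
open import Data.Sum using (_⊎_; inj₁; inj₂)
open import Relation.Binary.PropositionalEquality using (_≡_; _≢_; refl; cong₂) renaming (sym to ≡-sym)
open import Data.Empty using (⊥-elim)
open import Relation.Nullary using (¬_; does; yes; no)
open import Function.Bundles using (_⇔_)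

record Graph (n : ℕ) : Set where
  field
    adj    : Fin n → Fin n → Bool
    sym    : ∀ u v → adj u v ≡ adj v u
    irrefl : ∀ v → adj v v ≡ false
open Graph public

data Reach {n : ℕ} (Γ : Graph n) : Fin n → Fin n → Set where
  here : ∀ {v} → Reach Γ v v
  step : ∀ {u w v} → adj Γ u w ≡ true → Reach Γ w v → Reach Γ u v

Connected : ∀ {n} → Graph n → Set
Connected Γ = ∀ u v → Reach Γ u v

Bipartite : ∀ {n} → Graph n → Set
Bipartite {n} Γ = Σ (Fin n → Bool) λ c → ∀ u v → adj Γ u v ≡ true → c u ≢ c v

NonBipartite : ∀ {n} → Graph n → Set
NonBipartite Γ = ¬ Bipartite Γ

inN : ∀ {n} → Graph n → Fin n → Fin n → Bool
inN Γ v w = does (v ≟ᶠ w) ∨ adj Γ v w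

Σℕ : ∀ {n} → (Fin n → ℕ) → ℕ
Σℕ {zero}  f = 0
Σℕ {suc n} f = f zero ℕ.+ Σℕ (λ i → f (suc i))

Σℤ : ∀ {n} → (Fin n → ℤ) → ℤ
Σℤ {zero}  f = + 0
Σℤ {suc n} f = f zero + Σℤ (λ i → f (suc i))

count : ∀ {n} → (Fin n → Bool) → ℕ
count p = Σℕ (λ i → if p i then 1 else 0)

deg : ∀ {n} → Graph n → Fin n → ℕ
deg Γ v = count (adj Γ v)

commonClosed : ∀ {n} → Graph n → Fin n → Fin n → ℕ
commonClosed Γ u v = count (λ w → inN Γ u w ∧ inN Γ v w)

-- Tensor product Γ × K_m, vertex (a , b) encoded as combine a b : Fin (n * m)
-- (decoded by remQuot)

Kadj : ∀ {m} → Fin m → Fin m → Bool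
Kadj a b = not (does (a ≟ᶠ b))

Kadj-sym : ∀ {m} (a b : Fin m) → Kadj a b ≡ Kadj b a
Kadj-sym a b with a ≟ᶠ b | b ≟ᶠ a
... | yes _ | yes _ = refl
... | no _  | no _  = refl
... | yes p | no q  = ⊥-elim (q (≡-sym p))
... | no q  | yes p = ⊥-elim (q (≡-sym p))

Kadj-irrefl : ∀ {m} (a : Fin m) → Kadj a a ≡ false
Kadj-irrefl a with a ≟ᶠ a
... | yes _ = refl
... | no q  = ⊥-elim (q refl)

adjP : ∀ {n m} → Graph n → (Fin n × Fin m) → (Fin n × Fin m) → Bool
adjP Γ (a , b) (a' , b') = adj Γ a a' ∧ Kadj b b'

adjP-sym : ∀ {n m} (Γ : Graph n) (p q : Fin n × Fin m) → adjP Γ p q ≡ adjP Γ q p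
adjP-sym Γ (a , b) (a' , b') = cong₂ _∧_ (Graph.sym Γ a a') (Kadj-sym b b')

adjP-irrefl : ∀ {n m} (Γ : Graph n) (p : Fin n × Fin m) → adjP Γ p p ≡ false
adjP-irrefl Γ (a , b) rewrite Graph.irrefl Γ a = refl

tensorK : ∀ {n} → Graph n → (m : ℕ) → Graph (n ℕ.* m)
tensorK {n} Γ m = record
  { adj    = λ x y → adjP Γ (remQuot {n} m x) (remQuot {n} m y)
  ; sym    = λ x y → adjP-sym Γ (remQuot {n} m x) (remQuot {n} m y)
  ; irrefl = λ x → adjP-irrefl Γ (remQuot {n} m x)
  }

-- The RA matrix C_Δ: rows indexed by vertices v (row N[v]) and by pairs
-- (u , v) (row N[u] ∩ N[v]); entries 0/1 in ℤ.

RARow : ℕ → Set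
RARow n = Fin n ⊎ (Fin n × Fin n)

b2z : Bool → ℤ
b2z true  = + 1
b2z false = + 0

RAmatrix : ∀ {n} → Graph n → RARow n → Fin n → ℤ
RAmatrix Γ (inj₁ v)       w = b2z (inN Γ v w)
RAmatrix Γ (inj₂ (u , v)) w = b2z (inN Γ u w ∧ inN Γ v w)

ΣRow : ∀ {n} → (RARow n → ℤ) → ℤ
ΣRow f = Σℤ (λ v → f (inj₁ v)) + Σℤ (λ u → Σℤ (λ v → f (inj₂ (u , v))))

-- x lies in the ℤ-row span of the matrix C with columns reordered by σ
-- (column j of the reordered matrix is column σ j of C)
InRowSpanRA : ∀ {n} → Graph n → Permutation′ n → (Fin n → ℤ) → Set
InRowSpanRA {n} Γ σ x =
  Σ (RARow n → ℤ) λ c → ∀ j → x j ≡ ΣRow (λ r → c r * RAmatrix Γ r (σ ⟨$⟩ʳ j))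

InRowSpan : ∀ {n} → (Fin n → Fin n → ℤ) → (Fin n → ℤ) → Set
InRowSpan {n} H x = Σ (Fin n → ℤ) λ y → ∀ j → x j ≡ Σℤ (λ i → y i * H i j)

-- Hermite normal form (row style, upper triangular, full rank)

IsHNF : ∀ {n} → (Fin n → Fin n → ℤ) → Set
IsHNF {n} H =
    (∀ i j → toℕ j ℕ.< toℕ i → H i j ≡ + 0)
  × (∀ i → + 0 < H i i)
  × (∀ i j → toℕ i ℕ.< toℕ j → (+ 0 ≤ H i j) × (H i j < H j j))

IsHNFofRA : ∀ {n} → Graph n → Permutation′ n → (Fin n → Fin n → ℤ) → Set
IsHNFofRA {n} Γ σ H =
  IsHNF H × (∀ (x : Fin n → ℤ) → InRowSpan H x ⇔ InRowSpanRA Γ σ x)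

diagOnesK : (n k : ℕ) → Fin n → ℤ
diagOnesK n k i = if (suc (toℕ i) ≡ᵇ n) then + k else + 1

-- Δ is 1/k-RA
IsKRA : ℕ → ∀ {n} → Graph n → Set
IsKRA k {n} Γ =
  ∀ (σ : Permutation′ n) → Σ (Fin n → Fin n → ℤ) λ H →
    IsHNFofRA Γ σ H × (∀ i → H i i ≡ diagOnesK n k i)

-- Δ is RA (via the known characterization: row span of C_Δ is ℤ^n)
IsRA : ∀ {n} → Graph n → Set
IsRA {n} Γ = ∀ (x : Fin n → ℤ) → InRowSpanRA Γ Data.Fin.Permutation.id x

-- The row lattice of C_Δ, for Δ = Γ × K_m, always contains e_x - e_y and 2e_x for all vertices x, y.
-- Inside a fibre {w} × K_m the differences come from rows of three distinct colours (m ≥ 3); modulo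
-- them a vector is determined by its fibre sums, and the fibre sums of four suitable rows combine to
-- e_u + e_v for every edge uv of Γ. Walks then give e_u ± e_v, and an odd cycle fixes the sign and
-- gives 2e_u. So the lattice is either the even-sum lattice or all of ℤⁿ, according to whether every
-- row of C_Δ has even sum. The even-sum lattice is stable under column permutations, with Hermite
-- normal form I plus a last column of ones, of diagonal (1, …, 1, 2). The row sums are
-- |N[u] ∩ N[v]| - 2[u ~ v] + (m-2)|N(u) ∩ N(v)| for equal colours and 2[u ~ v] + (m-2)|N(u) ∩ N(v)|
-- otherwise; they are all even exactly when m and every |N[u] ∩ N[v]| are even, and the degree
-- condition is then automatic because |N[v]| = 1 + deg v.

{-# OPTIONS --safe #-}
module Submission where

open import Defs hiding (sym)
open import Data.Nat using (ℕ; _≤_; _*_)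
open import Data.Nat.Divisibility using (_∣_)
open import Data.Product using (_×_)
open import Data.Sum using (_⊎_)
open import Relation.Nullary using (¬_)
open import Function.Bundles using (_⇔_)

import Algebra.Properties.CommutativeMonoid.Sum as MonoidSum
open import Data.Bool using (Bool; true; false; _∧_; _∨_; not; if_then_else_)
import Data.Bool.Properties as 𝔹
open import Data.Empty using (⊥)
open import Data.Fin using (Fin; zero; suc; toℕ; fromℕ; combine; remQuot; _↑ˡ_; _↑ʳ_)
open import Data.Fin.Permutation as Perm using (Permutation′; _⟨$⟩ʳ_; _⟨$⟩ˡ_)
open import Data.Fin.Properties
  using (_≟_; all?; ¬∀⟶∃¬; toℕ-injective; toℕ-fromℕ; toℕ<n; suc-injective; remQuot-combine; combine-remQuot)
open import Data.Integer as ℤ using (ℤ; +_; 0ℤ; 1ℤ; _-_) renaming (_+_ to _⊕_; _*_ to _⊛_)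
import Data.Integer.Properties as ℤ
open import Algebra.Properties.CommutativeSemigroup ℤ.+-commutativeSemigroup using () renaming (interchange to +-interchange)
open import Data.Integer.Divisibility.Signed
  using (divides; ∣⇒∣ᵤ; ∣ᵤ⇒∣; ∣-refl; ∣m∣n⇒∣m+n; ∣m∣n⇒∣m-n; ∣n⇒∣m*n) renaming (_∣_ to _∣ᶻ_)
open import Data.Integer.Tactic.RingSolver using (solve-∀)
open import Data.Nat as ℕ using (zero; suc; s≤s; z≤n)
import Data.Nat.Divisibility as ℕ
import Data.Nat.Properties as ℕ
open import Data.Product using (∃; _,_; proj₁; proj₂)
import Data.Product.Properties as ×
open import Data.Sum using (inj₁; inj₂)
import Data.Sum.Properties as ⊎
open import Data.Sum.Properties using (inj₁-injective; inj₂-injective)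
open import Function using (_∘_)
open import Function.Bundles using (mk⇔; Equivalence)
open import Function.Properties.Equivalence using () renaming (trans to ⇔-trans; sym to ⇔-sym)
open import Relation.Binary using (tri<; tri≈; tri>)
open import Relation.Binary.PropositionalEquality
open import Relation.Nullary using (Dec; does; yes; no; contradiction; ¬?; _→-dec_; _×-dec_)
open import Relation.Nullary.Decidable using (dec-true; dec-false; does-⇔)

_≟ᵇ_ : ∀ {n} → Fin n → Fin n → Bool
i ≟ᵇ j = does (i ≟ j)

δ : ∀ {n} → Fin n → Fin n → ℤ
δ i j = b2z (i ≟ᵇ j)

δ-refl : ∀ {n} (i : Fin n) → δ i i ≡ 1ℤ
δ-refl i = cong b2z (dec-true (i ≟ i) refl)

δ-≢ : ∀ {n} {i j : Fin n} → i ≢ j → δ i j ≡ 0ℤ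
δ-≢ {i = i} {j} i≢j = cong b2z (dec-false (i ≟ j) i≢j)

Σ-cong : ∀ {n} {f g : Fin n → ℤ} → (∀ i → f i ≡ g i) → Σℤ f ≡ Σℤ g
Σ-cong {zero}  f≗g = refl
Σ-cong {suc n} f≗g = cong₂ _⊕_ (f≗g zero) (Σ-cong (f≗g ∘ suc))

Σ-zero : ∀ {n} {f : Fin n → ℤ} → (∀ i → f i ≡ 0ℤ) → Σℤ f ≡ 0ℤ
Σ-zero {zero}  f≗0 = refl
Σ-zero {suc n} f≗0 = cong₂ _⊕_ (f≗0 zero) (Σ-zero (f≗0 ∘ suc))

Σ-+ : ∀ {n} (f g : Fin n → ℤ) → Σℤ (λ i → f i ⊕ g i) ≡ Σℤ f ⊕ Σℤ g
Σ-+ {zero}  f g = refl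
Σ-+ {suc n} f g = trans (cong (f zero ⊕ g zero ⊕_) (Σ-+ (f ∘ suc) (g ∘ suc))) (+-interchange (f zero) (g zero) _ _)

Σ-*ˡ : ∀ {n} (c : ℤ) (f : Fin n → ℤ) → Σℤ (λ i → c ⊛ f i) ≡ c ⊛ Σℤ f
Σ-*ˡ {zero}  c f = sym (ℤ.*-zeroʳ c)
Σ-*ˡ {suc n} c f = trans (cong (c ⊛ f zero ⊕_) (Σ-*ˡ c (f ∘ suc))) (sym (ℤ.*-distribˡ-+ c (f zero) _))

Σ-*ʳ : ∀ {n} (c : ℤ) (f : Fin n → ℤ) → Σℤ (λ i → f i ⊛ c) ≡ Σℤ f ⊛ c
Σ-*ʳ c f = trans (Σ-cong (λ i → ℤ.*-comm (f i) c)) (trans (Σ-*ˡ c f) (ℤ.*-comm c (Σℤ f)))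

Σ-- : ∀ {n} (f g : Fin n → ℤ) → Σℤ (λ i → f i - g i) ≡ Σℤ f - Σℤ g
Σ-- f g = begin
  Σℤ (λ i → f i - g i)            ≡⟨ Σ-cong (λ i → cong (f i ⊕_) (sym (ℤ.-1*i≡-i (g i)))) ⟩
  Σℤ (λ i → f i ⊕ ℤ.-1ℤ ⊛ g i)    ≡⟨ Σ-+ f _ ⟩
  Σℤ f ⊕ Σℤ (λ i → ℤ.-1ℤ ⊛ g i)   ≡⟨ cong (Σℤ f ⊕_) (trans (Σ-*ˡ ℤ.-1ℤ g) (ℤ.-1*i≡-i (Σℤ g))) ⟩
  Σℤ f - Σℤ g                     ∎
  where open ≡-Reasoning

Σ-const : ∀ {n} (c : ℤ) → Σℤ {n} (λ _ → c) ≡ + n ⊛ c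
Σ-const {zero}  c = sym (ℤ.*-zeroˡ c)
Σ-const {suc n} c = trans (cong (c ⊕_) (Σ-const {n} c)) (sym (ℤ.suc-* (+ n) c))

Σ-single : ∀ {n} {f : Fin n → ℤ} (k : Fin n) → (∀ i → i ≢ k → f i ≡ 0ℤ) → Σℤ f ≡ f k
Σ-single {suc n} {f} zero    f≗0 = trans (cong (f zero ⊕_) (Σ-zero (λ i → f≗0 (suc i) λ ()))) (ℤ.+-identityʳ (f zero))
Σ-single {suc n} (suc k) f≗0 =
  trans (cong₂ _⊕_ (f≗0 zero λ ()) (Σ-single k (λ i i≢k → f≗0 (suc i) (i≢k ∘ suc-injective)))) (ℤ.+-identityˡ _)

Σ-δ : ∀ {n} (k : Fin n) → Σℤ (δ k) ≡ 1ℤ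
Σ-δ k = trans (Σ-single k (λ i i≢k → δ-≢ (i≢k ∘ sym))) (δ-refl k)

Σ-δʳ : ∀ {n} (k : Fin n) (f : Fin n → ℤ) → Σℤ (λ i → f i ⊛ δ i k) ≡ f k
Σ-δʳ k f = trans (Σ-single k (λ i i≢k → trans (cong (f i ⊛_) (δ-≢ i≢k)) (ℤ.*-zeroʳ (f i))))
                 (trans (cong (f k ⊛_) (δ-refl k)) (ℤ.*-identityʳ (f k)))

Σ-++ : ∀ {a b} (f : Fin (a ℕ.+ b) → ℤ) → Σℤ f ≡ Σℤ (λ i → f (i ↑ˡ b)) ⊕ Σℤ (λ j → f (a ↑ʳ j))
Σ-++ {zero}  f = sym (ℤ.+-identityˡ _)
Σ-++ {suc a} {b} f = trans (cong (f zero ⊕_) (Σ-++ {a} {b} (f ∘ suc))) (sym (ℤ.+-assoc (f zero) _ _))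

Σ-combine : ∀ {n m} (f : Fin (n * m) → ℤ) → Σℤ f ≡ Σℤ (λ w → Σℤ (λ d → f (combine {n} {m} w d)))
Σ-combine {zero}      f = refl
Σ-combine {suc n} {m} f =
  trans (Σ-++ {m} f) (cong (Σℤ (λ d → f (d ↑ˡ n * m)) ⊕_) (Σ-combine {n} (λ j → f (m ↑ʳ j))))

Σ-count : ∀ {n} (p : Fin n → Bool) → Σℤ (b2z ∘ p) ≡ + count p
Σ-count {zero}  p = refl
Σ-count {suc n} p with p zero
... | true  = cong (1ℤ ⊕_) (Σ-count (p ∘ suc))
... | false = trans (ℤ.+-identityˡ _) (Σ-count (p ∘ suc))

Σ-permute : ∀ {n} (σ : Permutation′ n) (f : Fin n → ℤ) → Σℤ (λ j → f (σ ⟨$⟩ʳ j)) ≡ Σℤ f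
Σ-permute σ f = trans (Σ≡sum (λ j → f (σ ⟨$⟩ʳ j))) (trans (sym (sum-permute f σ)) (sym (Σ≡sum f)))
  where
  open MonoidSum ℤ.+-0-commutativeMonoid using (sum; sum-permute)
  Σ≡sum : ∀ {n} (g : Fin n → ℤ) → Σℤ g ≡ sum g
  Σ≡sum {zero}  g = refl
  Σ≡sum {suc n} g = cong (g zero ⊕_) (Σ≡sum (g ∘ suc))

Σ-onPoint : ∀ {m} (g : Bool → ℤ) (a : Fin m) → Σℤ (λ d → g (a ≟ᵇ d)) ≡ g true ⊕ g false ⊛ (+ m - 1ℤ)
Σ-onPoint {m} g a = begin
  Σℤ (λ d → g (a ≟ᵇ d))                              ≡⟨ Σ-cong (λ d → affine (a ≟ᵇ d)) ⟩
  Σℤ (λ d → g false ⊕ (g true - g false) ⊛ δ a d)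
    ≡⟨ Σ-+ {m} (λ _ → g false) (λ d → (g true - g false) ⊛ δ a d) ⟩
  Σℤ {m} (λ _ → g false) ⊕ Σℤ (λ d → (g true - g false) ⊛ δ a d)
    ≡⟨ cong₂ _⊕_ (Σ-const {m} (g false)) (trans (Σ-*ˡ (g true - g false) (δ a)) (cong ((g true - g false) ⊛_) (Σ-δ a))) ⟩
  + m ⊛ g false ⊕ (g true - g false) ⊛ 1ℤ           ≡⟨ collect (g true) (g false) (+ m) ⟩
  g true ⊕ g false ⊛ (+ m - 1ℤ)                      ∎
  where
  open ≡-Reasoning
  affine : ∀ X → g X ≡ g false ⊕ (g true - g false) ⊛ b2z X
  affine true  = solve-true (g true) (g false)
    where
    solve-true : ∀ t f → t ≡ f ⊕ (t - f) ⊛ 1ℤ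
    solve-true = solve-∀
  affine false = solve-false (g true) (g false)
    where
    solve-false : ∀ t f → f ≡ f ⊕ (t - f) ⊛ 0ℤ
    solve-false = solve-∀
  collect : ∀ t f m → m ⊛ f ⊕ (t - f) ⊛ 1ℤ ≡ t ⊕ f ⊛ (m - 1ℤ)
  collect = solve-∀

Σ-onTwoPoints : ∀ {m} (g : Bool → Bool → ℤ) {a b : Fin m} → a ≢ b →
                Σℤ (λ d → g (a ≟ᵇ d) (b ≟ᵇ d)) ≡ g true false ⊕ g false true ⊕ g false false ⊛ (+ m - + 2)
Σ-onTwoPoints {m} g {a} {b} a≢b = begin
  Σℤ (λ d → g (a ≟ᵇ d) (b ≟ᵇ d))
    ≡⟨ Σ-cong affine ⟩
  Σℤ (λ d → g false false ⊕ (tf ⊛ δ a d ⊕ ft ⊛ δ b d))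
    ≡⟨ Σ-+ {m} (λ _ → g false false) (λ d → tf ⊛ δ a d ⊕ ft ⊛ δ b d) ⟩
  Σℤ {m} (λ _ → g false false) ⊕ Σℤ (λ d → tf ⊛ δ a d ⊕ ft ⊛ δ b d)
    ≡⟨ cong₂ _⊕_ (Σ-const {m} (g false false)) (Σ-+ (λ d → tf ⊛ δ a d) (λ d → ft ⊛ δ b d)) ⟩
  + m ⊛ g false false ⊕ (Σℤ (λ d → tf ⊛ δ a d) ⊕ Σℤ (λ d → ft ⊛ δ b d))
    ≡⟨ cong (+ m ⊛ g false false ⊕_) (cong₂ _⊕_ (trans (Σ-*ˡ tf (δ a)) (cong (tf ⊛_) (Σ-δ a)))
                                                  (trans (Σ-*ˡ ft (δ b)) (cong (ft ⊛_) (Σ-δ b)))) ⟩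
  + m ⊛ g false false ⊕ (tf ⊛ 1ℤ ⊕ ft ⊛ 1ℤ)
    ≡⟨ collect (g true false) (g false true) (g false false) (+ m) ⟩
  g true false ⊕ g false true ⊕ g false false ⊛ (+ m - + 2) ∎
  where
  open ≡-Reasoning
  tf = g true false - g false false
  ft = g false true - g false false
  affine : ∀ d → g (a ≟ᵇ d) (b ≟ᵇ d) ≡ g false false ⊕ (tf ⊛ δ a d ⊕ ft ⊛ δ b d)
  affine d with a ≟ d | b ≟ d
  ... | yes refl | yes refl = contradiction refl a≢b
  ... | yes _    | no _     = first (g true false) (g false true) (g false false)
    where
    first : ∀ x y z → x ≡ z ⊕ ((x - z) ⊛ 1ℤ ⊕ (y - z) ⊛ 0ℤ)
    first = solve-∀
  ... | no _     | yes _    = second (g true false) (g false true) (g false false)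
    where
    second : ∀ x y z → y ≡ z ⊕ ((x - z) ⊛ 0ℤ ⊕ (y - z) ⊛ 1ℤ)
    second = solve-∀
  ... | no _     | no _     = neither (g true false) (g false true) (g false false)
    where
    neither : ∀ x y z → z ≡ z ⊕ ((x - z) ⊛ 0ℤ ⊕ (y - z) ⊛ 0ℤ)
    neither = solve-∀
  collect : ∀ x y z m → m ⊛ z ⊕ ((x - z) ⊛ 1ℤ ⊕ (y - z) ⊛ 1ℤ) ≡ x ⊕ y ⊕ z ⊛ (m - + 2)
  collect = solve-∀

record IsLattice {I : Set} (L : (I → ℤ) → Set) : Set where
  field
    ∈-resp-≗ : ∀ {x y} → (∀ i → x i ≡ y i) → L x → L y
    0∈       : L (λ _ → 0ℤ)
    +-closed : ∀ {x y} → L x → L y → L (λ i → x i ⊕ y i)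
    *-closed : ∀ a {x} → L x → L (λ i → a ⊛ x i)

  -closed : ∀ {x y} → L x → L y → L (λ i → x i - y i)
  -closed {x} {y} x∈ y∈ =
    ∈-resp-≗ (λ i → cong (x i ⊕_) (ℤ.-1*i≡-i (y i))) (+-closed x∈ (*-closed ℤ.-1ℤ y∈))

  Σ-closed : ∀ {K} (v : Fin K → I → ℤ) → (∀ k → L (v k)) → L (λ i → Σℤ (λ k → v k i))
  Σ-closed {zero}  v v∈ = 0∈
  Σ-closed {suc K} v v∈ = +-closed (v∈ zero) (Σ-closed (v ∘ suc) (v∈ ∘ suc))

  ∈⇔summand∈ : ∀ {w v z} → L w → (∀ i → w i ⊕ v i ≡ z i) → L z ⇔ L v
  ∈⇔summand∈ {w} {v} w∈ w+v≗z = mk⇔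
    (λ z∈ → ∈-resp-≗ (λ i → trans (cong (_- w i) (sym (w+v≗z i))) (cancel (w i) (v i))) (-closed z∈ w∈))
    (λ v∈ → ∈-resp-≗ w+v≗z (+-closed w∈ v∈))
    where
    cancel : ∀ a b → a ⊕ b - a ≡ b
    cancel = solve-∀

IsLattice-∘ : ∀ {I J : Set} {L : (I → ℤ) → Set} → IsLattice L → (g : I → J) →
              IsLattice (λ (f : J → ℤ) → L (f ∘ g))
IsLattice-∘ isLattice g = record
  { ∈-resp-≗ = λ x≗y → ∈-resp-≗ (x≗y ∘ g)
  ; 0∈       = 0∈
  ; +-closed = λ x∈ y∈ → +-closed x∈ y∈
  ; *-closed = λ a x∈ → *-closed a x∈
  }
  where open IsLattice isLattice

ΣRow-cong : ∀ {n} {f g : RARow n → ℤ} → (∀ r → f r ≡ g r) → ΣRow f ≡ ΣRow g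
ΣRow-cong f≗g = cong₂ _⊕_ (Σ-cong (f≗g ∘ inj₁)) (Σ-cong (λ u → Σ-cong (λ v → f≗g (inj₂ (u , v)))))

ΣRow-zero : ∀ {n} {f : RARow n → ℤ} → (∀ r → f r ≡ 0ℤ) → ΣRow f ≡ 0ℤ
ΣRow-zero f≗0 = cong₂ _⊕_ (Σ-zero (f≗0 ∘ inj₁)) (Σ-zero (λ u → Σ-zero (λ v → f≗0 (inj₂ (u , v)))))

ΣRow-+ : ∀ {n} (f g : RARow n → ℤ) → ΣRow (λ r → f r ⊕ g r) ≡ ΣRow f ⊕ ΣRow g
ΣRow-+ f g = trans (cong₂ _⊕_ (Σ-+ (f ∘ inj₁) (g ∘ inj₁))
                              (trans (Σ-cong (λ u → Σ-+ (λ v → f (inj₂ (u , v))) (λ v → g (inj₂ (u , v)))))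
                                     (Σ-+ (λ u → Σℤ (λ v → f (inj₂ (u , v)))) (λ u → Σℤ (λ v → g (inj₂ (u , v)))))))
                   (+-interchange (Σℤ (f ∘ inj₁)) (Σℤ (g ∘ inj₁)) _ _)

ΣRow-*ˡ : ∀ {n} (c : ℤ) (f : RARow n → ℤ) → ΣRow (λ r → c ⊛ f r) ≡ c ⊛ ΣRow f
ΣRow-*ˡ c f = trans (cong₂ _⊕_ (Σ-*ˡ c (f ∘ inj₁))
                                (trans (Σ-cong (λ u → Σ-*ˡ c (λ v → f (inj₂ (u , v)))))
                                       (Σ-*ˡ c (λ u → Σℤ (λ v → f (inj₂ (u , v)))))))
                    (sym (ℤ.*-distribˡ-+ c _ _))

ΣRow-single : ∀ {n} {f : RARow n → ℤ} (r : RARow n) → (∀ s → s ≢ r → f s ≡ 0ℤ) → ΣRow f ≡ f r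
ΣRow-single {f = f} (inj₁ v) f≗0 =
  trans (cong₂ _⊕_ (Σ-single v (λ v′ v′≢v → f≗0 (inj₁ v′) (v′≢v ∘ inj₁-injective)))
                   (Σ-zero (λ u → Σ-zero (λ v′ → f≗0 (inj₂ (u , v′)) λ ()))))
        (ℤ.+-identityʳ (f (inj₁ v)))
ΣRow-single {f = f} (inj₂ (u , v)) f≗0 =
  trans (cong₂ _⊕_ (Σ-zero (λ v′ → f≗0 (inj₁ v′) λ ()))
                   (trans (Σ-single u (λ u′ u′≢u → Σ-zero (λ v′ →
                                 f≗0 (inj₂ (u′ , v′)) (u′≢u ∘ cong proj₁ ∘ inj₂-injective))))
                          (Σ-single v (λ v′ v′≢v → f≗0 (inj₂ (u , v′)) (v′≢v ∘ cong proj₂ ∘ inj₂-injective)))))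
        (ℤ.+-identityˡ (f (inj₂ (u , v))))

ΣRow-closed : ∀ {n} {L : (Fin n → ℤ) → Set} → IsLattice L →
              (v : RARow n → Fin n → ℤ) → (∀ r → L (v r)) → L (λ j → ΣRow (λ r → v r j))
ΣRow-closed isLattice v v∈ =
  +-closed (Σ-closed (v ∘ inj₁) (v∈ ∘ inj₁))
           (Σ-closed _ (λ u → Σ-closed (λ w → v (inj₂ (u , w))) (λ w → v∈ (inj₂ (u , w)))))
  where open IsLattice isLattice

RowSpan : ∀ {n} → Graph n → (Fin n → ℤ) → Set
RowSpan Γ = InRowSpanRA Γ Perm.id

RowSpan-isLattice : ∀ {n} (Γ : Graph n) → IsLattice (RowSpan Γ)
RowSpan-isLattice Γ = record
  { ∈-resp-≗ = λ x≗y (c , x≡) → c , λ j → trans (sym (x≗y j)) (x≡ j)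
  ; 0∈       = (λ _ → 0ℤ) , λ j → sym (ΣRow-zero (λ r → ℤ.*-zeroˡ (RAmatrix Γ r j)))
  ; +-closed = λ (c , x≡) (c′ , y≡) → (λ r → c r ⊕ c′ r) , λ j → sym (begin
      ΣRow (λ r → (c r ⊕ c′ r) ⊛ RAmatrix Γ r j)
        ≡⟨ ΣRow-cong (λ r → ℤ.*-distribʳ-+ (RAmatrix Γ r j) (c r) (c′ r)) ⟩
      ΣRow (λ r → c r ⊛ RAmatrix Γ r j ⊕ c′ r ⊛ RAmatrix Γ r j)
        ≡⟨ ΣRow-+ (λ r → c r ⊛ RAmatrix Γ r j) (λ r → c′ r ⊛ RAmatrix Γ r j) ⟩
      ΣRow (λ r → c r ⊛ RAmatrix Γ r j) ⊕ ΣRow (λ r → c′ r ⊛ RAmatrix Γ r j)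
        ≡⟨ sym (cong₂ _⊕_ (x≡ j) (y≡ j)) ⟩
      _ ∎)
  ; *-closed = λ a (c , x≡) → (λ r → a ⊛ c r) , λ j → sym (begin
      ΣRow (λ r → a ⊛ c r ⊛ RAmatrix Γ r j)   ≡⟨ ΣRow-cong (λ r → ℤ.*-assoc a (c r) (RAmatrix Γ r j)) ⟩
      ΣRow (λ r → a ⊛ (c r ⊛ RAmatrix Γ r j)) ≡⟨ ΣRow-*ˡ a (λ r → c r ⊛ RAmatrix Γ r j) ⟩
      a ⊛ ΣRow (λ r → c r ⊛ RAmatrix Γ r j)   ≡⟨ cong (a ⊛_) (sym (x≡ j)) ⟩
      _ ∎)
  }
  where open ≡-Reasoning

row∈RowSpan : ∀ {n} (Γ : Graph n) (r : RARow n) → RowSpan Γ (RAmatrix Γ r)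
row∈RowSpan Γ r = (λ s → b2z (does (s ≟ᴿ r))) , λ j → sym (trans
  (ΣRow-single r (λ s s≢r → trans (cong (λ b → b2z b ⊛ RAmatrix Γ s j) (dec-false (s ≟ᴿ r) s≢r))
                                   (ℤ.*-zeroˡ (RAmatrix Γ s j))))
  (trans (cong (λ b → b2z b ⊛ RAmatrix Γ r j) (dec-true (r ≟ᴿ r) refl)) (ℤ.*-identityˡ _)))
  where
  _≟ᴿ_ = ⊎.≡-dec _≟_ (×.≡-dec _≟_ _≟_)

RowSpan-minimal : ∀ {n} (Γ : Graph n) {L : (Fin n → ℤ) → Set} → IsLattice L →
                  (∀ r → L (RAmatrix Γ r)) → ∀ {x} → RowSpan Γ x → L x
RowSpan-minimal Γ isLattice rows∈ (c , x≡) =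
  ∈-resp-≗ (sym ∘ x≡) (ΣRow-closed isLattice _ (λ r → *-closed (c r) (rows∈ r)))
  where open IsLattice isLattice

RowSpan-permute : ∀ {n} (Γ : Graph n) (σ : Permutation′ n) (x : Fin n → ℤ) →
                  InRowSpanRA Γ σ x ⇔ RowSpan Γ (λ k → x (σ ⟨$⟩ˡ k))
RowSpan-permute Γ σ x = mk⇔
  (λ (c , x≡) → c , λ k →
     trans (x≡ (σ ⟨$⟩ˡ k)) (cong (λ i → ΣRow (λ r → c r ⊛ RAmatrix Γ r i)) (Perm.inverseʳ σ)))
  (λ (c , x≡) → c , λ j → trans (cong x (sym (Perm.inverseˡ σ))) (x≡ (σ ⟨$⟩ʳ j)))

EvenSum : ∀ {n} → (Fin n → ℤ) → Set
EvenSum x = + 2 ∣ᶻ Σℤ x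

OddSum : ∀ {n} → (Fin n → ℤ) → Set
OddSum x = + 2 ∣ᶻ 1ℤ ⊕ Σℤ x

EvenSum-isLattice : ∀ {n} → IsLattice (EvenSum {n})
EvenSum-isLattice {n} = record
  { ∈-resp-≗ = λ x≗y → subst (+ 2 ∣ᶻ_) (Σ-cong x≗y)
  ; 0∈       = divides 0ℤ (Σ-zero {n} (λ _ → refl))
  ; +-closed = λ {x} {y} 2∣x 2∣y → subst (+ 2 ∣ᶻ_) (sym (Σ-+ x y)) (∣m∣n⇒∣m+n 2∣x 2∣y)
  ; *-closed = λ a {x} 2∣x → subst (+ 2 ∣ᶻ_) (sym (Σ-*ˡ a x)) (∣n⇒∣m*n a 2∣x)
  }

even⊎odd : ∀ t → 2 ∣ t ⊎ 2 ∣ suc t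
even⊎odd zero    = inj₁ (ℕ.divides 0 refl)
even⊎odd (suc t) with even⊎odd t
... | inj₁ 2∣t   = inj₂ (ℕ.∣m∣n⇒∣m+n (ℕ.∣-refl {2}) 2∣t)
... | inj₂ 2∣1+t = inj₁ 2∣1+t

2∣⇒2∣ᶻ : ∀ {t} → 2 ∣ t → + 2 ∣ᶻ + t
2∣⇒2∣ᶻ {t} = ∣ᵤ⇒∣ {+ 2} {+ t}

2∤1 : ¬ (+ 2 ∣ᶻ 1ℤ)
2∤1 2∣1 = contradiction (ℕ.∣1⇒≡1 (∣⇒∣ᵤ 2∣1)) λ ()

Σ-decomposition : ∀ {n} (x₀ : Fin n) (z : Fin n → ℤ) (j : Fin n) →
                  Σℤ (λ i → z i ⊛ (δ i j - δ x₀ j)) ⊕ Σℤ z ⊛ δ x₀ j ≡ z j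
Σ-decomposition x₀ z j = begin
  Σℤ (λ i → z i ⊛ (δ i j - δ x₀ j)) ⊕ Σℤ z ⊛ δ x₀ j
    ≡⟨ cong (_⊕ Σℤ z ⊛ δ x₀ j) (Σ-cong (λ i → distrib (z i) (δ i j) (δ x₀ j))) ⟩
  Σℤ (λ i → z i ⊛ δ i j - z i ⊛ δ x₀ j) ⊕ Σℤ z ⊛ δ x₀ j
    ≡⟨ cong (_⊕ Σℤ z ⊛ δ x₀ j) (trans (Σ-- (λ i → z i ⊛ δ i j) (λ i → z i ⊛ δ x₀ j))
                                       (cong₂ _-_ (Σ-δʳ j z) (Σ-*ʳ (δ x₀ j) z))) ⟩
  z j - Σℤ z ⊛ δ x₀ j ⊕ Σℤ z ⊛ δ x₀ j
    ≡⟨ cancel (z j) (Σℤ z ⊛ δ x₀ j) ⟩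
  z j ∎
  where
  open ≡-Reasoning
  distrib : ∀ a b c → a ⊛ (b - c) ≡ a ⊛ b - a ⊛ c
  distrib = solve-∀
  cancel : ∀ a b → a - b ⊕ b ≡ a
  cancel = solve-∀

module _ {N} {L : (Fin N → ℤ) → Set} (isLattice : IsLattice L) (x₀ : Fin N)
         (diff∈ : ∀ x y → L (λ j → δ x j - δ y j)) where
  open IsLattice isLattice

  private
    differences∈ : ∀ (z : Fin N → ℤ) → L (λ j → Σℤ (λ i → z i ⊛ (δ i j - δ x₀ j)))
    differences∈ z = Σ-closed (λ i j → z i ⊛ (δ i j - δ x₀ j)) (λ i → *-closed (z i) (diff∈ i x₀))

  ∈⇔sum·base∈ : ∀ (z : Fin N → ℤ) → L z ⇔ L (λ j → Σℤ z ⊛ δ x₀ j)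
  ∈⇔sum·base∈ z = ∈⇔summand∈ (differences∈ z) (Σ-decomposition x₀ z)

  evenSum⊆ : L (λ j → + 2 ⊛ δ x₀ j) → ∀ {z} → EvenSum z → L z
  evenSum⊆ 2e∈ {z} (divides q Σz≡q2) = Equivalence.from (∈⇔sum·base∈ z)
    (∈-resp-≗ (λ j → trans (sym (ℤ.*-assoc q (+ 2) (δ x₀ j))) (cong (_⊛ δ x₀ j) (sym Σz≡q2))) (*-closed q 2e∈))

  oddSum⇒all : L (λ j → + 2 ⊛ δ x₀ j) → ∀ {o} → L o → OddSum o → ∀ z → L z
  oddSum⇒all 2e∈ {o} o∈ (divides q 1+Σo≡q2) z = Equivalence.from (∈⇔sum·base∈ z) (*-closed (Σℤ z) e∈)
    where
    unit : ∀ d → q ⊛ (+ 2 ⊛ d) - Σℤ o ⊛ d ≡ d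
    unit d = begin
      q ⊛ (+ 2 ⊛ d) - Σℤ o ⊛ d         ≡⟨ factor q (Σℤ o) d ⟩
      (q ⊛ + 2 - Σℤ o) ⊛ d             ≡⟨ cong (λ t → (t - Σℤ o) ⊛ d) (sym 1+Σo≡q2) ⟩
      (1ℤ ⊕ Σℤ o - Σℤ o) ⊛ d           ≡⟨ cancel (Σℤ o) d ⟩
      d                                ∎
      where
      open ≡-Reasoning
      factor : ∀ q s d → q ⊛ (+ 2 ⊛ d) - s ⊛ d ≡ (q ⊛ + 2 - s) ⊛ d
      factor = solve-∀
      cancel : ∀ s d → (1ℤ ⊕ s - s) ⊛ d ≡ d
      cancel = solve-∀
    e∈ : L (δ x₀)
    e∈ = ∈-resp-≗ (unit ∘ δ x₀) (-closed (*-closed q 2e∈) (Equivalence.to (∈⇔sum·base∈ o) o∈))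

diagOnesK-isLast : ∀ {N′} k (i : Fin (suc N′)) → diagOnesK (suc N′) k i ≡ (if fromℕ N′ ≟ᵇ i then + k else 1ℤ)
diagOnesK-isLast {N′} k i =
  cong (if_then + k else 1ℤ) (does-⇔ (mk⇔ toℕ≡N′⇒last last⇒toℕ≡N′) (toℕ i ℕ.≟ N′) (fromℕ N′ ≟ i))
  where
  toℕ≡N′⇒last : toℕ i ≡ N′ → fromℕ N′ ≡ i
  toℕ≡N′⇒last p = toℕ-injective (trans (toℕ-fromℕ N′) (sym p))
  last⇒toℕ≡N′ : fromℕ N′ ≡ i → toℕ i ≡ N′
  last⇒toℕ≡N′ refl = toℕ-fromℕ N′

below⇒≢last : ∀ {N′} {i j : Fin (suc N′)} → toℕ i ℕ.< toℕ j → i ≢ fromℕ N′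
below⇒≢last {N′} {j = j} i<j refl = ℕ.<⇒≱ (subst (ℕ._< toℕ j) (toℕ-fromℕ N′) i<j) (ℕ.s≤s⁻¹ (toℕ<n j))

evenSumHNF : ∀ {N′} → Fin (suc N′) → Fin (suc N′) → ℤ
evenSumHNF {N′} i j = δ i j ⊕ δ (fromℕ N′) j

evenSumHNF-isHNF : ∀ {N′} → IsHNF (evenSumHNF {N′})
evenSumHNF-isHNF {N′} = triangular , pivots , reduced
  where
  triangular : ∀ i j → toℕ j ℕ.< toℕ i → evenSumHNF i j ≡ 0ℤ
  triangular i j j<i = cong₂ _⊕_ (δ-≢ {i = i} {j} (λ { refl → ℕ.<-irrefl refl j<i })) (δ-≢ (≢-sym (below⇒≢last j<i)))
  pivots : ∀ i → 0ℤ ℤ.< evenSumHNF i i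
  pivots i rewrite δ-refl i with fromℕ N′ ≟ᵇ i
  ... | true  = ℤ.+<+ (s≤s z≤n)
  ... | false = ℤ.+<+ (s≤s z≤n)
  reduced : ∀ i j → toℕ i ℕ.< toℕ j → (0ℤ ℤ.≤ evenSumHNF i j) × (evenSumHNF i j ℤ.< evenSumHNF j j)
  reduced i j i<j rewrite δ-≢ {i = i} {j} (λ { refl → ℕ.<-irrefl refl i<j }) | δ-refl j with fromℕ N′ ≟ᵇ j
  ... | true  = ℤ.+≤+ z≤n , ℤ.+<+ (s≤s (s≤s z≤n))
  ... | false = ℤ.+≤+ z≤n , ℤ.+<+ (s≤s z≤n)

evenSumHNF-diag : ∀ {N′} (i : Fin (suc N′)) → evenSumHNF i i ≡ diagOnesK (suc N′) 2 i
evenSumHNF-diag {N′} i rewrite δ-refl i | diagOnesK-isLast 2 i with fromℕ N′ ≟ᵇ i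
... | true  = refl
... | false = refl

evenSumHNF-combination : ∀ {N′} (y : Fin (suc N′) → ℤ) (j : Fin (suc N′)) →
                         Σℤ (λ i → y i ⊛ evenSumHNF i j) ≡ y j ⊕ Σℤ y ⊛ δ (fromℕ N′) j
evenSumHNF-combination {N′} y j = begin
  Σℤ (λ i → y i ⊛ (δ i j ⊕ δ L j))         ≡⟨ Σ-cong (λ i → ℤ.*-distribˡ-+ (y i) (δ i j) (δ L j)) ⟩
  Σℤ (λ i → y i ⊛ δ i j ⊕ y i ⊛ δ L j)     ≡⟨ Σ-+ (λ i → y i ⊛ δ i j) (λ i → y i ⊛ δ L j) ⟩
  Σℤ (λ i → y i ⊛ δ i j) ⊕ Σℤ (λ i → y i ⊛ δ L j) ≡⟨ cong₂ _⊕_ (Σ-δʳ j y) (Σ-*ʳ (δ L j) y) ⟩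
  y j ⊕ Σℤ y ⊛ δ L j                        ∎
  where
  open ≡-Reasoning
  L = fromℕ N′

span-evenSumHNF : ∀ {N′} (x : Fin (suc N′) → ℤ) → InRowSpan evenSumHNF x ⇔ EvenSum x
span-evenSumHNF {N′} x = mk⇔ ⇒ ⇐
  where
  L = fromℕ N′
  ⇒ : InRowSpan evenSumHNF x → EvenSum x
  ⇒ (y , x≡) = divides (Σℤ y) (begin
    Σℤ x                                ≡⟨ Σ-cong (λ j → trans (x≡ j) (evenSumHNF-combination y j)) ⟩
    Σℤ (λ j → y j ⊕ Σℤ y ⊛ δ L j)       ≡⟨ Σ-+ y (λ j → Σℤ y ⊛ δ L j) ⟩
    Σℤ y ⊕ Σℤ (λ j → Σℤ y ⊛ δ L j)
      ≡⟨ cong (Σℤ y ⊕_) (trans (Σ-*ˡ (Σℤ y) (δ L)) (cong (Σℤ y ⊛_) (Σ-δ L))) ⟩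
    Σℤ y ⊕ Σℤ y ⊛ 1ℤ                    ≡⟨ double (Σℤ y) ⟩
    Σℤ y ⊛ + 2                          ∎)
    where
    open ≡-Reasoning
    double : ∀ a → a ⊕ a ⊛ 1ℤ ≡ a ⊛ + 2
    double = solve-∀
  ⇐ : EvenSum x → InRowSpan evenSumHNF x
  ⇐ (divides q Σx≡q2) = y , λ j → sym (begin
    Σℤ (λ i → y i ⊛ evenSumHNF i j)   ≡⟨ evenSumHNF-combination y j ⟩
    y j ⊕ Σℤ y ⊛ δ L j                ≡⟨ cong (λ t → y j ⊕ t ⊛ δ L j) Σy≡q ⟩
    x j - q ⊛ δ L j ⊕ q ⊛ δ L j       ≡⟨ cancel (x j) (q ⊛ δ L j) ⟩
    x j                               ∎)
    where
    open ≡-Reasoning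
    y : Fin (suc N′) → ℤ
    y j = x j - q ⊛ δ L j
    cancel : ∀ a b → a - b ⊕ b ≡ a
    cancel = solve-∀
    halve : ∀ q → q ⊛ + 2 - q ⊛ 1ℤ ≡ q
    halve = solve-∀
    Σy≡q : Σℤ y ≡ q
    Σy≡q = begin
      Σℤ y                          ≡⟨ Σ-- x (λ j → q ⊛ δ L j) ⟩
      Σℤ x - Σℤ (λ j → q ⊛ δ L j)   ≡⟨ cong₂ _-_ Σx≡q2 (trans (Σ-*ˡ q (δ L)) (cong (q ⊛_) (Σ-δ L))) ⟩
      q ⊛ + 2 - q ⊛ 1ℤ              ≡⟨ halve q ⟩
      q                             ∎

EvenSum-permute : ∀ {n} (σ : Permutation′ n) (x : Fin n → ℤ) → EvenSum x ⇔ EvenSum (λ k → x (σ ⟨$⟩ˡ k))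
EvenSum-permute σ x = mk⇔ (subst (+ 2 ∣ᶻ_) (sym Σ-σ⁻¹)) (subst (+ 2 ∣ᶻ_) Σ-σ⁻¹)
  where
  Σ-σ⁻¹ : Σℤ (λ k → x (σ ⟨$⟩ˡ k)) ≡ Σℤ x
  Σ-σ⁻¹ = Σ-permute (Perm.flip σ) x

RowSpan⇔EvenSum⇒IsKRA2 : ∀ {N′} (Γ : Graph (suc N′)) → (∀ x → RowSpan Γ x ⇔ EvenSum x) → IsKRA 2 Γ
RowSpan⇔EvenSum⇒IsKRA2 Γ span⇔even σ =
  evenSumHNF , (evenSumHNF-isHNF , spanσ⇔) , evenSumHNF-diag
  where
  spanσ⇔ : ∀ x → InRowSpan evenSumHNF x ⇔ InRowSpanRA Γ σ x
  spanσ⇔ x = ⇔-trans (span-evenSumHNF x) (⇔-trans (EvenSum-permute σ x)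
               (⇔-trans (⇔-sym (span⇔even _)) (⇔-sym (RowSpan-permute Γ σ x))))

-- Triangularity and the unit pivots force all coefficients but the last to vanish, leaving 1 = 2 y_last.
lastUnit∉HNF : ∀ {N′} {H : Fin (suc N′) → Fin (suc N′) → ℤ} →
               IsHNF H → (∀ i → H i i ≡ diagOnesK (suc N′) 2 i) →
               ¬ InRowSpan H (δ (fromℕ N′))
lastUnit∉HNF {N′} {H} (triangular , _ , _) diag (y , e≡) = 2∤1 (divides (y L) (begin
  1ℤ                             ≡⟨ sym (δ-refl L) ⟩
  δ L L                          ≡⟨ e≡ L ⟩
  Σℤ (λ i → y i ⊛ H i L)
    ≡⟨ Σ-single L (λ i i≢L → trans (cong (_⊛ H i L) (y≡0 (suc N′) i (toℕ<n i) i≢L)) (ℤ.*-zeroˡ (H i L))) ⟩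
  y L ⊛ H L L
    ≡⟨ cong (y L ⊛_) (trans (diag L) (trans (diagOnesK-isLast 2 L) (cong (if_then + 2 else 1ℤ) (dec-true (L ≟ L) refl)))) ⟩
  y L ⊛ + 2                      ∎))
  where
  open ≡-Reasoning
  L = fromℕ N′
  Hjj≡1 : ∀ j → j ≢ L → H j j ≡ 1ℤ
  Hjj≡1 j j≢L = trans (diag j) (trans (diagOnesK-isLast 2 j) (cong (if_then + 2 else 1ℤ) (dec-false (L ≟ j) (j≢L ∘ sym))))
  y≡0 : ∀ t j → toℕ j ℕ.< t → j ≢ L → y j ≡ 0ℤ
  y≡0 (suc t) j j<1+t j≢L = begin
    y j                          ≡⟨ sym (ℤ.*-identityʳ (y j)) ⟩
    y j ⊛ 1ℤ                     ≡⟨ cong (y j ⊛_) (sym (Hjj≡1 j j≢L)) ⟩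
    y j ⊛ H j j                  ≡⟨ sym (Σ-single j others) ⟩
    Σℤ (λ i → y i ⊛ H i j)       ≡⟨ sym (e≡ j) ⟩
    δ L j                        ≡⟨ δ-≢ (j≢L ∘ sym) ⟩
    0ℤ                           ∎
    where
    others : ∀ i → i ≢ j → y i ⊛ H i j ≡ 0ℤ
    others i i≢j with ℕ.<-cmp (toℕ i) (toℕ j)
    ... | tri< i<j _ _ =
      trans (cong (_⊛ H i j) (y≡0 t i (ℕ.<-≤-trans i<j (ℕ.s≤s⁻¹ j<1+t)) (below⇒≢last i<j))) (ℤ.*-zeroˡ (H i j))
    ... | tri≈ _ i≡j _ = contradiction (toℕ-injective i≡j) i≢j
    ... | tri> _ _ j<i = trans (cong (y i ⊛_) (triangular i j j<i)) (ℤ.*-zeroʳ (y i))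

¬IsKRA2×IsRA : ∀ {N′} (Γ : Graph (suc N′)) → IsKRA 2 Γ → IsRA Γ → ⊥
¬IsKRA2×IsRA {N′} Γ kra ra with kra Perm.id
... | H , (isHNF , span⇔) , diag = lastUnit∉HNF isHNF diag (Equivalence.from (span⇔ e) (ra e))
  where
  e = δ (fromℕ N′)

b2z-∧ : ∀ p q → b2z (p ∧ q) ≡ b2z p ⊛ b2z q
b2z-∧ true  q = sym (ℤ.*-identityˡ (b2z q))
b2z-∧ false q = sym (ℤ.*-zeroˡ (b2z q))

b2z-∨ : ∀ p q → p ∧ q ≡ false → b2z (p ∨ q) ≡ b2z p ⊕ b2z q
b2z-∨ true  true  ()
b2z-∨ true  false _ = refl
b2z-∨ false q     _ = sym (ℤ.+-identityˡ (b2z q))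

self∧adj≡false : ∀ {n} (Γ : Graph n) (u w : Fin n) → (u ≟ᵇ w) ∧ adj Γ u w ≡ false
self∧adj≡false Γ u w with u ≟ w
... | yes refl = Graph.irrefl Γ u
... | no _     = refl

adj∧self≡false : ∀ {n} (Γ : Graph n) (u w : Fin n) → adj Γ u w ∧ (u ≟ᵇ w) ≡ false
adj∧self≡false Γ u w = trans (𝔹.∧-comm (adj Γ u w) (u ≟ᵇ w)) (self∧adj≡false Γ u w)

self∧self≡false : ∀ {n} {u v : Fin n} → u ≢ v → ∀ w → (u ≟ᵇ w) ∧ (v ≟ᵇ w) ≡ false
self∧self≡false {u = u} {v} u≢v w with u ≟ w
... | yes refl = dec-false (v ≟ u) (u≢v ∘ sym)
... | no _     = refl

self∧adj≡self : ∀ {n} (Γ : Graph n) {u v : Fin n} → adj Γ v u ≡ true → ∀ w → (u ≟ᵇ w) ∧ adj Γ v w ≡ (u ≟ᵇ w)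
self∧adj≡self Γ {u} v~u w with u ≟ w
... | yes refl = v~u
... | no _     = refl

adj∧self≡self : ∀ {n} (Γ : Graph n) {u v : Fin n} → adj Γ u v ≡ true → ∀ w → adj Γ u w ∧ (v ≟ᵇ w) ≡ (v ≟ᵇ w)
adj∧self≡self Γ {u} {v} u~v w =
  trans (𝔹.∧-comm (adj Γ u w) (v ≟ᵇ w)) (self∧adj≡self Γ u~v w)

adj⇒≢ : ∀ {n} (Γ : Graph n) {u v : Fin n} → adj Γ u v ≡ true → u ≢ v
adj⇒≢ Γ {u} u~v refl with trans (sym u~v) (Graph.irrefl Γ u)
... | ()

nonBipartite⇒monochromaticEdge : ∀ {n} (Γ : Graph n) → NonBipartite Γ → (c : Fin n → Bool) →
                                 ∃ λ u → ∃ λ v → adj Γ u v ≡ true × c u ≡ c v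
nonBipartite⇒monochromaticEdge {n} Γ nonBip c = u , v , improper (proj₂ v∃)
  where
  Proper : Fin n → Fin n → Set
  Proper u v = adj Γ u v ≡ true → c u ≢ c v
  Proper? : ∀ u v → Dec (Proper u v)
  Proper? u v = (adj Γ u v 𝔹.≟ true) →-dec ¬? (c u 𝔹.≟ c v)
  u∃ = ¬∀⟶∃¬ n (λ u → ∀ v → Proper u v) (λ u → all? (Proper? u)) (λ proper → nonBip (c , proper))
  u = proj₁ u∃
  v∃ = ¬∀⟶∃¬ n (Proper u) (Proper? u) (proj₂ u∃)
  v = proj₁ v∃
  improper : ¬ Proper u v → adj Γ u v ≡ true × c u ≡ c v
  improper ¬p with adj Γ u v 𝔹.≟ true | c u 𝔹.≟ c v
  ... | yes a | yes e = a , e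
  ... | no ¬a | _     = contradiction (λ a → contradiction a ¬a) ¬p
  ... | _     | no ¬e = contradiction (λ _ → ¬e) ¬p

isInj₁ : ∀ {A B : Set} → A ⊎ B → Bool
isInj₁ (inj₁ _) = true
isInj₁ (inj₂ _) = false

module _ {n} {Γ : Graph n} {L : (Fin n → ℤ) → Set} (isLattice : IsLattice L)
         (edge∈ : ∀ u v → adj Γ u v ≡ true → L (λ w → δ u w ⊕ δ v w)) where
  open IsLattice isLattice

  walk∈ : ∀ {u v} → Reach Γ u v → L (λ w → δ u w - δ v w) ⊎ L (λ w → δ u w ⊕ δ v w)
  walk∈ {u} here = inj₁ (∈-resp-≗ (λ w → sym (ℤ.+-inverseʳ (δ u w))) 0∈)
  walk∈ {u} {v} (step {w = x} u~x x⇝v) with walk∈ x⇝v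
  ... | inj₁ x-v∈ = inj₂ (∈-resp-≗ (λ w → flip (δ u w) (δ x w) (δ v w)) (-closed (edge∈ u x u~x) x-v∈))
    where
    flip : ∀ a b c → a ⊕ b - (b - c) ≡ a ⊕ c
    flip = solve-∀
  ... | inj₂ x+v∈ = inj₁ (∈-resp-≗ (λ w → flip (δ u w) (δ x w) (δ v w)) (-closed (edge∈ u x u~x) x+v∈))
    where
    flip : ∀ a b c → a ⊕ b - (b ⊕ c) ≡ a - c
    flip = solve-∀

  module _ (connected : Connected Γ) (nonBipartite : NonBipartite Γ) where

    -- Colour each vertex by the sign with which walk∈ reaches it from r; a monochromatic edge
    -- closes an odd cycle.
    double∈ : ∀ r → L (λ w → + 2 ⊛ δ r w)
    double∈ r with nonBipartite⇒monochromaticEdge Γ nonBipartite (λ v → isInj₁ (walk∈ (connected r v)))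
    ... | u , v , u~v , same = closeTriangle (walk∈ (connected r u)) (walk∈ (connected r v)) same
      where
      closeTriangle : (ru : L (λ w → δ r w - δ u w) ⊎ L (λ w → δ r w ⊕ δ u w))
                      (rv : L (λ w → δ r w - δ v w) ⊎ L (λ w → δ r w ⊕ δ v w)) →
                      isInj₁ ru ≡ isInj₁ rv → L (λ w → + 2 ⊛ δ r w)
      closeTriangle (inj₁ r-u∈) (inj₁ r-v∈) _ =
        ∈-resp-≗ (λ w → sum (δ r w) (δ u w) (δ v w)) (+-closed (+-closed r-u∈ r-v∈) (edge∈ u v u~v))
        where
        sum : ∀ a b c → a - b ⊕ (a - c) ⊕ (b ⊕ c) ≡ + 2 ⊛ a
        sum = solve-∀
      closeTriangle (inj₂ r+u∈) (inj₂ r+v∈) _ =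
        ∈-resp-≗ (λ w → sum (δ r w) (δ u w) (δ v w)) (-closed (+-closed r+u∈ r+v∈) (edge∈ u v u~v))
        where
        sum : ∀ a b c → a ⊕ b ⊕ (a ⊕ c) - (b ⊕ c) ≡ + 2 ⊛ a
        sum = solve-∀
      closeTriangle (inj₁ _) (inj₂ _) ()
      closeTriangle (inj₂ _) (inj₁ _) ()

    difference∈ : ∀ u v → L (λ w → δ u w - δ v w)
    difference∈ u v with walk∈ (connected u v)
    ... | inj₁ u-v∈ = u-v∈
    ... | inj₂ u+v∈ = ∈-resp-≗ (λ w → sum (δ u w) (δ v w)) (-closed u+v∈ (double∈ v))
      where
      sum : ∀ a b → a ⊕ b - + 2 ⊛ b ≡ a - b
      sum = solve-∀

module Neighbourhoods {n} (Γ : Graph n) where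

  A : Fin n → Fin n → ℤ
  A u w = b2z (adj Γ u w)

  bothAdj : Fin n → Fin n → Fin n → ℤ
  bothAdj u v w = b2z (adj Γ u w ∧ adj Γ v w)

  codegree : Fin n → Fin n → ℤ
  codegree u v = Σℤ (bothAdj u v)

  Σ-self∧ : ∀ u (p : Fin n → Bool) → Σℤ (λ w → b2z ((u ≟ᵇ w) ∧ p w)) ≡ b2z (p u)
  Σ-self∧ u p = trans (Σ-single u (λ w w≢u → cong (λ t → b2z (t ∧ p w)) (dec-false (u ≟ w) (w≢u ∘ sym))))
                      (cong (λ t → b2z (t ∧ p u)) (dec-true (u ≟ u) refl))

  Σ-∧self : ∀ (p : Fin n → Bool) v → Σℤ (λ w → b2z (p w ∧ (v ≟ᵇ w))) ≡ b2z (p v)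
  Σ-∧self p v = trans (Σ-cong (λ w → cong b2z (𝔹.∧-comm (p w) (v ≟ᵇ w)))) (Σ-self∧ v p)

  commonClosed≡ : ∀ u v → + commonClosed Γ u v ≡ δ v u ⊕ A v u ⊕ A u v ⊕ codegree u v
  commonClosed≡ u v = begin
    + commonClosed Γ u v
      ≡⟨ sym (Σ-count (λ w → inN Γ u w ∧ inN Γ v w)) ⟩
    Σℤ (λ w → b2z (inN Γ u w ∧ inN Γ v w))
      ≡⟨ Σ-cong expand ⟩
    Σℤ (λ w → UV w ⊕ UK w ⊕ JV w ⊕ bothAdj u v w)
      ≡⟨ trans (Σ-+ (λ w → UV w ⊕ UK w ⊕ JV w) (bothAdj u v))
               (cong (_⊕ codegree u v)
                     (trans (Σ-+ (λ w → UV w ⊕ UK w) JV) (cong₂ _⊕_ (Σ-+ UV UK) (Σ-∧self (adj Γ u) v)))) ⟩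
    Σℤ UV ⊕ Σℤ UK ⊕ A u v ⊕ codegree u v
      ≡⟨ cong (λ t → t ⊕ A u v ⊕ codegree u v) (cong₂ _⊕_ (Σ-self∧ u (v ≟ᵇ_)) (Σ-self∧ u (adj Γ v))) ⟩
    δ v u ⊕ A v u ⊕ A u v ⊕ codegree u v ∎
    where
    open ≡-Reasoning
    UV UK JV : Fin n → ℤ
    UV w = b2z ((u ≟ᵇ w) ∧ (v ≟ᵇ w))
    UK w = b2z ((u ≟ᵇ w) ∧ adj Γ v w)
    JV w = b2z (adj Γ u w ∧ (v ≟ᵇ w))
    expand : ∀ w → b2z (inN Γ u w ∧ inN Γ v w) ≡ UV w ⊕ UK w ⊕ JV w ⊕ bothAdj u v w
    expand w = begin
      b2z (inN Γ u w ∧ inN Γ v w)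
        ≡⟨ b2z-∧ (inN Γ u w) (inN Γ v w) ⟩
      b2z (inN Γ u w) ⊛ b2z (inN Γ v w)
        ≡⟨ cong₂ _⊛_ (b2z-∨ (u ≟ᵇ w) (adj Γ u w) (self∧adj≡false Γ u w))
                     (b2z-∨ (v ≟ᵇ w) (adj Γ v w) (self∧adj≡false Γ v w)) ⟩
      (b2z (u ≟ᵇ w) ⊕ A u w) ⊛ (b2z (v ≟ᵇ w) ⊕ A v w)
        ≡⟨ distrib (b2z (u ≟ᵇ w)) (A u w) (b2z (v ≟ᵇ w)) (A v w) ⟩
      b2z (u ≟ᵇ w) ⊛ b2z (v ≟ᵇ w) ⊕ b2z (u ≟ᵇ w) ⊛ A v w ⊕ A u w ⊛ b2z (v ≟ᵇ w) ⊕ A u w ⊛ A v w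
        ≡⟨ sym (cong₂ _⊕_ (cong₂ _⊕_ (cong₂ _⊕_ (b2z-∧ (u ≟ᵇ w) (v ≟ᵇ w)) (b2z-∧ (u ≟ᵇ w) (adj Γ v w)))
                                       (b2z-∧ (adj Γ u w) (v ≟ᵇ w))) (b2z-∧ (adj Γ u w) (adj Γ v w))) ⟩
      UV w ⊕ UK w ⊕ JV w ⊕ bothAdj u v w ∎
      where
      distrib : ∀ a b c d → (a ⊕ b) ⊛ (c ⊕ d) ≡ a ⊛ c ⊕ a ⊛ d ⊕ b ⊛ c ⊕ b ⊛ d
      distrib = solve-∀

  commonClosed-self : ∀ v → commonClosed Γ v v ≡ suc (deg Γ v)
  commonClosed-self v = ℤ.+-injective (begin
    + commonClosed Γ v v                    ≡⟨ commonClosed≡ v v ⟩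
    δ v v ⊕ A v v ⊕ A v v ⊕ codegree v v
      ≡⟨ cong₂ (λ s t → s ⊕ t ⊕ t ⊕ codegree v v) (δ-refl v) (cong b2z (Graph.irrefl Γ v)) ⟩
    1ℤ ⊕ codegree v v
      ≡⟨ cong (1ℤ ⊕_) (trans (Σ-cong (λ w → cong b2z (𝔹.∧-idem (adj Γ v w)))) (Σ-count (adj Γ v))) ⟩
    + suc (deg Γ v)                         ∎)
    where open ≡-Reasoning

  evenCommonClosed⇒oddDegree : ∀ v → 2 ∣ commonClosed Γ v v → ¬ 2 ∣ deg Γ v
  evenCommonClosed⇒oddDegree v 2∣cc 2∣deg =
    2∤1 (2∣⇒2∣ᶻ (ℕ.∣m+n∣m⇒∣n (subst (2 ∣_) (trans (commonClosed-self v) (ℕ.+-comm 1 (deg Γ v))) 2∣cc) 2∣deg))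

≟ᵇ-remQuot : ∀ {n} m (x z : Fin (n * m)) →
             (x ≟ᵇ z) ≡ (proj₁ (remQuot {n} m x) ≟ᵇ proj₁ (remQuot {n} m z))
                      ∧ (proj₂ (remQuot {n} m x) ≟ᵇ proj₂ (remQuot {n} m z))
≟ᵇ-remQuot {n} m x z = does-⇔ (mk⇔ components combined) (x ≟ z) ((u ≟ w) ×-dec (a ≟ d))
  where
  u = proj₁ (remQuot {n} m x)
  a = proj₂ (remQuot {n} m x)
  w = proj₁ (remQuot {n} m z)
  d = proj₂ (remQuot {n} m z)
  components : x ≡ z → u ≡ w × a ≡ d
  components refl = refl , refl
  combined : u ≡ w × a ≡ d → x ≡ z
  combined (u≡w , a≡d) = trans (sym (combine-remQuot {n} m x)) (trans (cong₂ combine u≡w a≡d) (combine-remQuot {n} m z))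

HasThirdColour : ℕ → Set
HasThirdColour m = ∀ (a b : Fin m) → ∃ λ c → a ≢ c × b ≢ c

thirdColour : ∀ {k} → HasThirdColour (3 ℕ.+ k)
thirdColour zero          zero          = suc zero , (λ ()) , (λ ())
thirdColour zero          (suc zero)    = suc (suc zero) , (λ ()) , (λ ())
thirdColour zero          (suc (suc _)) = suc zero , (λ ()) , (λ ())
thirdColour (suc zero)    zero          = suc (suc zero) , (λ ()) , (λ ())
thirdColour (suc zero)    (suc _)       = zero , (λ ()) , (λ ())
thirdColour (suc (suc _)) zero          = suc zero , (λ ()) , (λ ())
thirdColour (suc (suc _)) (suc _)       = zero , (λ ()) , (λ ())

module TensorK {n} (Γ : Graph n) (m : ℕ) where
  open Neighbourhoods Γ

  Point : Set
  Point = Fin n × Fin m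

  nbhd : Point → Point → Bool
  nbhd (u , a) (w , d) = if a ≟ᵇ d then u ≟ᵇ w else adj Γ u w

  common : Point → Point → Point → ℤ
  common p q x = b2z (nbhd p x ∧ nbhd q x)

  infixr 7 _⊗_
  _⊗_ : (Fin n → ℤ) → (Fin m → ℤ) → Point → ℤ
  (h ⊗ g) (w , d) = h w ⊛ g d

  fibreSum : (Point → ℤ) → Fin n → ℤ
  fibreSum f w = Σℤ (λ d → f (w , d))

  e : Point → Point → ℤ
  e (u , a) = δ u ⊗ δ a

  Δ : Graph (n * m)
  Δ = tensorK Γ m

  point : Fin (n * m) → Point
  point = remQuot {n} m

  flat : Point → Fin (n * m)
  flat (u , a) = combine {n} {m} u a

  inN-tensorK : ∀ x z → inN Δ x z ≡ nbhd (point x) (point z)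
  inN-tensorK x z = trans (cong (_∨ adj Δ x z) (≟ᵇ-remQuot {n} m x z)) (select (proj₂ (point x) ≟ᵇ proj₂ (point z)) _ _)
    where
    select : ∀ X U J → (U ∧ X) ∨ (J ∧ not X) ≡ (if X then U else J)
    select true  true  J = refl
    select true  false J = 𝔹.∧-zeroʳ J
    select false true  J = 𝔹.∧-identityʳ J
    select false false J = 𝔹.∧-identityʳ J

  point-flat : ∀ p → point (flat p) ≡ p
  point-flat (u , a) = remQuot-combine u a

  row-common : ∀ x y z → RAmatrix Δ (inj₂ (x , y)) z ≡ common (point x) (point y) (point z)
  row-common x y z = cong b2z (cong₂ _∧_ (inN-tensorK x z) (inN-tensorK y z))

  δ-point : ∀ x z → δ x z ≡ e (point x) (point z)
  δ-point x z = trans (cong b2z (≟ᵇ-remQuot {n} m x z))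
                      (b2z-∧ (proj₁ (point x) ≟ᵇ proj₁ (point z)) (proj₂ (point x) ≟ᵇ proj₂ (point z)))

  Σ-point : ∀ f → Σℤ (f ∘ point) ≡ Σℤ (fibreSum f)
  Σ-point f = trans (Σ-combine {n} {m} (f ∘ point)) (Σ-cong (λ w → Σ-cong (λ d → cong f (remQuot-combine w d))))

  PointSpan : (Point → ℤ) → Set
  PointSpan f = RowSpan Δ (f ∘ point)

  PointSpan-isLattice : IsLattice PointSpan
  PointSpan-isLattice = IsLattice-∘ (RowSpan-isLattice Δ) point

  common∈PointSpan : ∀ p q → PointSpan (common p q)
  common∈PointSpan p q = IsLattice.∈-resp-≗ (RowSpan-isLattice Δ)
    (λ z → trans (row-common (flat p) (flat q) z) (cong₂ (λ p′ q′ → common p′ q′ (point z)) (point-flat p) (point-flat q)))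
    (row∈RowSpan Δ (inj₂ (flat p , flat q)))

  IsLattice-⊗ : ∀ {L : (Point → ℤ) → Set} → IsLattice L → (g : Fin m → ℤ) → IsLattice (λ h → L (h ⊗ g))
  IsLattice-⊗ isLattice g = record
    { ∈-resp-≗ = λ h≗h′ → ∈-resp-≗ (λ (w , d) → cong (_⊛ g d) (h≗h′ w))
    ; 0∈       = ∈-resp-≗ (λ (_ , d) → sym (ℤ.*-zeroˡ (g d))) 0∈
    ; +-closed = λ {h} {h′} h∈ h′∈ →
                   ∈-resp-≗ (λ (w , d) → sym (ℤ.*-distribʳ-+ (g d) (h w) (h′ w))) (+-closed h∈ h′∈)
    ; *-closed = λ a {h} h∈ → ∈-resp-≗ (λ (w , d) → sym (ℤ.*-assoc a (h w) (g d))) (*-closed a h∈)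
    }
    where open IsLattice isLattice

  fibreSum-common-same : ∀ u v a w → fibreSum (common (u , a) (v , a)) w ≡
                         b2z ((u ≟ᵇ w) ∧ (v ≟ᵇ w)) ⊕ bothAdj u v w ⊛ (+ m - 1ℤ)
  fibreSum-common-same u v a w =
    Σ-onPoint (λ X → b2z ((if X then u ≟ᵇ w else adj Γ u w) ∧ (if X then v ≟ᵇ w else adj Γ v w))) a

  fibreSum-common-distinct : ∀ u v {a b} → a ≢ b → ∀ w → fibreSum (common (u , a) (v , b)) w ≡
                             b2z ((u ≟ᵇ w) ∧ adj Γ v w) ⊕ b2z (adj Γ u w ∧ (v ≟ᵇ w)) ⊕ bothAdj u v w ⊛ (+ m - + 2)
  fibreSum-common-distinct u v a≢b w =
    Σ-onTwoPoints (λ X Y → b2z ((if X then u ≟ᵇ w else adj Γ u w) ∧ (if Y then v ≟ᵇ w else adj Γ v w))) a≢b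

  fibreSum-vertexRow : ∀ u a w → fibreSum (common (u , a) (u , a)) w ≡ δ u w ⊕ A u w ⊛ (+ m - 1ℤ)
  fibreSum-vertexRow u a w = trans (fibreSum-common-same u u a w)
    (cong₂ (λ s t → b2z s ⊕ b2z t ⊛ (+ m - 1ℤ)) (𝔹.∧-idem (u ≟ᵇ w)) (𝔹.∧-idem (adj Γ u w)))

  fibreSum-vertexPair : ∀ u {a b} → a ≢ b → ∀ w → fibreSum (common (u , a) (u , b)) w ≡ A u w ⊛ (+ m - + 2)
  fibreSum-vertexPair u {a} {b} a≢b w = begin
    fibreSum (common (u , a) (u , b)) w
      ≡⟨ fibreSum-common-distinct u u a≢b w ⟩
    b2z ((u ≟ᵇ w) ∧ adj Γ u w) ⊕ b2z (adj Γ u w ∧ (u ≟ᵇ w)) ⊕ bothAdj u u w ⊛ (+ m - + 2)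
      ≡⟨ cong₂ (λ s t → b2z s ⊕ b2z t ⊕ bothAdj u u w ⊛ (+ m - + 2))
               (self∧adj≡false Γ u w) (adj∧self≡false Γ u w) ⟩
    0ℤ ⊕ 0ℤ ⊕ bothAdj u u w ⊛ (+ m - + 2)
      ≡⟨ ℤ.+-identityˡ _ ⟩
    bothAdj u u w ⊛ (+ m - + 2)
      ≡⟨ cong (λ t → b2z t ⊛ (+ m - + 2)) (𝔹.∧-idem (adj Γ u w)) ⟩
    A u w ⊛ (+ m - + 2) ∎
    where open ≡-Reasoning

  fibreSum-pair : ∀ {u v} → u ≢ v → ∀ a w → fibreSum (common (u , a) (v , a)) w ≡ bothAdj u v w ⊛ (+ m - 1ℤ)
  fibreSum-pair {u} {v} u≢v a w = trans (fibreSum-common-same u v a w)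
    (trans (cong (λ s → b2z s ⊕ bothAdj u v w ⊛ (+ m - 1ℤ)) (self∧self≡false u≢v w)) (ℤ.+-identityˡ _))

  fibreSum-edge : ∀ {u v} → adj Γ u v ≡ true → ∀ {a b} → a ≢ b → ∀ w →
                  fibreSum (common (u , a) (v , b)) w ≡ δ u w ⊕ δ v w ⊕ bothAdj u v w ⊛ (+ m - + 2)
  fibreSum-edge {u} {v} u~v a≢b w = trans (fibreSum-common-distinct u v a≢b w)
    (cong₂ (λ s t → b2z s ⊕ b2z t ⊕ bothAdj u v w ⊛ (+ m - + 2))
           (self∧adj≡self Γ (trans (Graph.sym Γ v u) u~v) w) (adj∧self≡self Γ u~v w))

  fibreSum-e : ∀ p w → fibreSum (e p) w ≡ δ (proj₁ p) w
  fibreSum-e (u , a) w = trans (Σ-*ˡ (δ u w) (δ a)) (trans (cong (δ u w ⊛_) (Σ-δ a)) (ℤ.*-identityʳ (δ u w)))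

  nbhd-common : ∀ w {a c} → a ≢ c → ∀ x →
                b2z (nbhd (w , a) x) - common (w , a) (w , c) x ≡ (δ w ⊗ δ a) x ⊕ (A w ⊗ δ c) x
  nbhd-common w {a} {c} a≢c (w′ , d) with a ≟ d | c ≟ d
  ... | yes refl | yes refl = contradiction refl a≢c
  ... | yes _    | no _     =
    trans (cong (λ t → b2z (w ≟ᵇ w′) - b2z t) (self∧adj≡false Γ w w′)) (onlySelf (δ w w′) (A w w′))
    where
    onlySelf : ∀ s j → s - 0ℤ ≡ s ⊛ 1ℤ ⊕ j ⊛ 0ℤ
    onlySelf = solve-∀
  ... | no _     | yes _    =
    trans (cong (λ t → b2z (adj Γ w w′) - b2z t) (adj∧self≡false Γ w w′)) (onlyAdj (δ w w′) (A w w′))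
    where
    onlyAdj : ∀ s j → j - 0ℤ ≡ s ⊛ 0ℤ ⊕ j ⊛ 1ℤ
    onlyAdj = solve-∀
  ... | no _     | no _     =
    trans (cong (λ t → b2z (adj Γ w w′) - b2z t) (𝔹.∧-idem (adj Γ w w′))) (neither (δ w w′) (A w w′))
    where
    neither : ∀ s j → j - j ≡ s ⊛ 0ℤ ⊕ j ⊛ 0ℤ
    neither = solve-∀

  module _ {V : (Fin n → ℤ) → Set} (isLattice : IsLattice V) (fibreSum∈ : ∀ p q → V (fibreSum (common p q)))
           {c₀ c₁ : Fin m} (c₀≢c₁ : c₀ ≢ c₁) where
    open IsLattice isLattice

    -- The coefficients make the A- and bothAdj-terms cancel, leaving ((m-1) - (m-2)) (e_u + e_v).
    edge∈ : ∀ u v → adj Γ u v ≡ true → V (λ w → δ u w ⊕ δ v w)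
    edge∈ u v u~v = ∈-resp-≗ (λ w → cancel (δ u w) (δ v w) (bothAdj u v w) (A u w) (A v w) (+ m))
      (-closed (-closed (-closed (*-closed k₁ Q∈) (*-closed k₂ P∈))
                            (-closed (*-closed k₂ (R∈ u)) (*-closed k₁ (S∈ u))))
                 (-closed (*-closed k₂ (R∈ v)) (*-closed k₁ (S∈ v))))
      where
      k₁ k₂ : ℤ
      k₁ = + m - 1ℤ
      k₂ = + m - + 2
      Q∈ : V (λ w → δ u w ⊕ δ v w ⊕ bothAdj u v w ⊛ k₂)
      Q∈ = ∈-resp-≗ (fibreSum-edge u~v c₀≢c₁) (fibreSum∈ (u , c₀) (v , c₁))
      P∈ : V (λ w → bothAdj u v w ⊛ k₁)
      P∈ = ∈-resp-≗ (fibreSum-pair (adj⇒≢ Γ u~v) c₀) (fibreSum∈ (u , c₀) (v , c₀))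
      R∈ : ∀ x → V (λ w → δ x w ⊕ A x w ⊛ k₁)
      R∈ x = ∈-resp-≗ (fibreSum-vertexRow x c₀) (fibreSum∈ (x , c₀) (x , c₀))
      S∈ : ∀ x → V (λ w → A x w ⊛ k₂)
      S∈ x = ∈-resp-≗ (fibreSum-vertexPair x c₀≢c₁) (fibreSum∈ (x , c₀) (x , c₁))
      cancel : ∀ eu ev b au av m →
        (m - 1ℤ) ⊛ (eu ⊕ ev ⊕ b ⊛ (m - + 2)) - (m - + 2) ⊛ (b ⊛ (m - 1ℤ))
          - ((m - + 2) ⊛ (eu ⊕ au ⊛ (m - 1ℤ)) - (m - 1ℤ) ⊛ (au ⊛ (m - + 2)))
          - ((m - + 2) ⊛ (ev ⊕ av ⊛ (m - 1ℤ)) - (m - 1ℤ) ⊛ (av ⊛ (m - + 2))) ≡ eu ⊕ ev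
      cancel = solve-∀

  module Spanning {L : (Point → ℤ) → Set} (isLattice : IsLattice L) (common∈ : ∀ p q → L (common p q))
                  (c₀ : Fin m) (third : HasThirdColour m) where
    open IsLattice isLattice

    nbhd∈ : ∀ p → L (b2z ∘ nbhd p)
    nbhd∈ p = ∈-resp-≗ (λ x → cong b2z (𝔹.∧-idem (nbhd p x))) (common∈ p p)

    fibreDifference∈ : ∀ w a b → L (δ w ⊗ (λ d → δ a d - δ b d))
    fibreDifference∈ w a b with third a b
    ... | c , a≢c , b≢c = ∈-resp-≗ pointwise (-closed (-closed (nbhd∈ (w , a)) (common∈ (w , a) (w , c)))
                                                       (-closed (nbhd∈ (w , b)) (common∈ (w , b) (w , c))))
      where
      cancel : ∀ s j x y z → s ⊛ x ⊕ j ⊛ z - (s ⊛ y ⊕ j ⊛ z) ≡ s ⊛ (x - y)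
      cancel = solve-∀
      pointwise : ∀ x → b2z (nbhd (w , a) x) - common (w , a) (w , c) x - (b2z (nbhd (w , b) x) - common (w , b) (w , c) x)
                        ≡ (δ w ⊗ (λ d → δ a d - δ b d)) x
      pointwise x@(w′ , d) = trans (cong₂ _-_ (nbhd-common w a≢c x) (nbhd-common w b≢c x))
                                   (cancel (δ w w′) (A w w′) (δ a d) (δ b d) (δ c d))

    private
      toBase : Point → Point → ℤ
      toBase (w , d) = δ w ⊗ (λ d′ → δ d d′ - δ c₀ d′)

      fibreDifferences∈ : ∀ (f : Point → ℤ) → L (λ x → Σℤ (λ w → Σℤ (λ d → f (w , d) ⊛ toBase (w , d) x)))
      fibreDifferences∈ f = Σ-closed (λ w x → Σℤ (λ d → f (w , d) ⊛ toBase (w , d) x))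
        (λ w → Σ-closed (λ d x → f (w , d) ⊛ toBase (w , d) x) (λ d → *-closed (f (w , d)) (fibreDifference∈ w d c₀)))

      fibre-decomposition : ∀ (f : Point → ℤ) x →
                            Σℤ (λ w → Σℤ (λ d → f (w , d) ⊛ toBase (w , d) x)) ⊕ (fibreSum f ⊗ δ c₀) x ≡ f x
      fibre-decomposition f (w′ , d′) = begin
        Σℤ (λ w → Σℤ (λ d → f (w , d) ⊛ (δ w w′ ⊛ D d))) ⊕ fibreSum f w′ ⊛ δ c₀ d′
          ≡⟨ cong (_⊕ fibreSum f w′ ⊛ δ c₀ d′) (Σ-cong (λ w → trans (Σ-cong (λ d → swap (f (w , d)) (δ w w′) (D d)))
                                                                     (Σ-*ʳ (δ w w′) (λ d → f (w , d) ⊛ D d)))) ⟩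
        Σℤ (λ w → Σℤ (λ d → f (w , d) ⊛ D d) ⊛ δ w w′) ⊕ fibreSum f w′ ⊛ δ c₀ d′
          ≡⟨ cong (_⊕ fibreSum f w′ ⊛ δ c₀ d′) (Σ-δʳ w′ (λ w → Σℤ (λ d → f (w , d) ⊛ D d))) ⟩
        Σℤ (λ d → f (w′ , d) ⊛ D d) ⊕ fibreSum f w′ ⊛ δ c₀ d′
          ≡⟨ Σ-decomposition c₀ (λ d → f (w′ , d)) d′ ⟩
        f (w′ , d′) ∎
        where
        open ≡-Reasoning
        D : Fin m → ℤ
        D d = δ d d′ - δ c₀ d′
        swap : ∀ a b c → a ⊛ (b ⊛ c) ≡ a ⊛ c ⊛ b
        swap = solve-∀

    ∈⇔fibreSum∈ : ∀ (f : Point → ℤ) → L f ⇔ L (fibreSum f ⊗ δ c₀)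
    ∈⇔fibreSum∈ f = ∈⇔summand∈ (fibreDifferences∈ f) (fibre-decomposition f)

    VertexSpan : (Fin n → ℤ) → Set
    VertexSpan h = L (h ⊗ δ c₀)

    VertexSpan-isLattice : IsLattice VertexSpan
    VertexSpan-isLattice = IsLattice-⊗ isLattice (δ c₀)

    private
      fibreSum∈ : ∀ p q → VertexSpan (fibreSum (common p q))
      fibreSum∈ p q = Equivalence.to (∈⇔fibreSum∈ (common p q)) (common∈ p q)

      c₀≢c₁ : c₀ ≢ proj₁ (third c₀ c₀)
      c₀≢c₁ = proj₁ (proj₂ (third c₀ c₀))

      ∈⇐fibreSum : ∀ {f h} → (∀ w → h w ≡ fibreSum f w) → VertexSpan h → L f
      ∈⇐fibreSum {f} {h} h≗ h∈ =
        Equivalence.from (∈⇔fibreSum∈ f) (IsLattice.∈-resp-≗ VertexSpan-isLattice {h} {fibreSum f} h≗ h∈)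

    module _ (connected : Connected Γ) (nonBipartite : NonBipartite Γ) where
      private
        edge∈V = edge∈ VertexSpan-isLattice fibreSum∈ c₀≢c₁

      pointDifference∈ : ∀ p q → L (λ x → e p x - e q x)
      pointDifference∈ p@(u , _) q@(v , _) =
        ∈⇐fibreSum (λ w → sym (trans (Σ-- (λ d → e p (w , d)) (λ d → e q (w , d)))
                                     (cong₂ _-_ (fibreSum-e p w) (fibreSum-e q w))))
                   (difference∈ VertexSpan-isLattice edge∈V connected nonBipartite u v)

      pointDouble∈ : ∀ p → L (λ x → + 2 ⊛ e p x)
      pointDouble∈ p@(u , _) =
        ∈⇐fibreSum (λ w → sym (trans (Σ-*ˡ (+ 2) (λ d → e p (w , d))) (cong (+ 2 ⊛_) (fibreSum-e p w))))
                   (double∈ VertexSpan-isLattice edge∈V connected nonBipartite u)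

  module _ (connected : Connected Γ) (nonBipartite : NonBipartite Γ) (c₀ : Fin m)
           (third : HasThirdColour m) where
    open Spanning PointSpan-isLattice common∈PointSpan c₀ third
    open IsLattice (RowSpan-isLattice Δ)

    difference∈RowSpan : ∀ x y → RowSpan Δ (λ z → δ x z - δ y z)
    difference∈RowSpan x y =
      ∈-resp-≗ (λ z → sym (cong₂ _-_ (δ-point x z) (δ-point y z)))
               (pointDifference∈ connected nonBipartite (point x) (point y))

    double∈RowSpan : ∀ x → RowSpan Δ (λ z → + 2 ⊛ δ x z)
    double∈RowSpan x = ∈-resp-≗ (λ z → sym (cong (+ 2 ⊛_) (δ-point x z))) (pointDouble∈ connected nonBipartite (point x))

  rowSum-common : ∀ x y → Σℤ (RAmatrix Δ (inj₂ (x , y))) ≡ Σℤ (fibreSum (common (point x) (point y)))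
  rowSum-common x y = trans (Σ-cong (row-common x y)) (Σ-point (common (point x) (point y)))

  rowSum-flat : ∀ p q → Σℤ (RAmatrix Δ (inj₂ (flat p , flat q))) ≡ Σℤ (fibreSum (common p q))
  rowSum-flat p q = trans (rowSum-common (flat p) (flat q))
    (cong₂ (λ p′ q′ → Σℤ (fibreSum (common p′ q′))) (point-flat p) (point-flat q))

  rowSum-sameColour : ∀ u v a → Σℤ (fibreSum (common (u , a) (v , a))) ≡ δ v u ⊕ codegree u v ⊛ (+ m - 1ℤ)
  rowSum-sameColour u v a = begin
    Σℤ (fibreSum (common (u , a) (v , a)))
      ≡⟨ Σ-cong (fibreSum-common-same u v a) ⟩
    Σℤ (λ w → b2z ((u ≟ᵇ w) ∧ (v ≟ᵇ w)) ⊕ bothAdj u v w ⊛ (+ m - 1ℤ))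
      ≡⟨ Σ-+ (λ w → b2z ((u ≟ᵇ w) ∧ (v ≟ᵇ w))) (λ w → bothAdj u v w ⊛ (+ m - 1ℤ)) ⟩
    Σℤ (λ w → b2z ((u ≟ᵇ w) ∧ (v ≟ᵇ w))) ⊕ Σℤ (λ w → bothAdj u v w ⊛ (+ m - 1ℤ))
      ≡⟨ cong₂ _⊕_ (Σ-self∧ u (v ≟ᵇ_)) (Σ-*ʳ (+ m - 1ℤ) (bothAdj u v)) ⟩
    δ v u ⊕ codegree u v ⊛ (+ m - 1ℤ) ∎
    where open ≡-Reasoning

  rowSum-sameColour-commonClosed : ∀ u v a → Σℤ (fibreSum (common (u , a) (v , a))) ≡
                     + commonClosed Γ u v - A u v ⊛ + 2 ⊕ codegree u v ⊛ (+ m - + 2)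
  rowSum-sameColour-commonClosed u v a = begin
    Σℤ (fibreSum (common (u , a) (v , a)))                      ≡⟨ rowSum-sameColour u v a ⟩
    δ v u ⊕ codegree u v ⊛ (+ m - 1ℤ)                           ≡⟨ regroup (δ v u) (A u v) (codegree u v) (+ m) ⟩
    δ v u ⊕ A u v ⊕ A u v ⊕ codegree u v - A u v ⊛ + 2 ⊕ codegree u v ⊛ (+ m - + 2)
      ≡⟨ cong (λ t → δ v u ⊕ t ⊕ A u v ⊕ codegree u v - A u v ⊛ + 2 ⊕ codegree u v ⊛ (+ m - + 2))
              (cong b2z (Graph.sym Γ u v)) ⟩
    δ v u ⊕ A v u ⊕ A u v ⊕ codegree u v - A u v ⊛ + 2 ⊕ codegree u v ⊛ (+ m - + 2)
      ≡⟨ cong (λ t → t - A u v ⊛ + 2 ⊕ codegree u v ⊛ (+ m - + 2)) (sym (commonClosed≡ u v)) ⟩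
    + commonClosed Γ u v - A u v ⊛ + 2 ⊕ codegree u v ⊛ (+ m - + 2) ∎
    where
    open ≡-Reasoning
    regroup : ∀ d a c m → d ⊕ c ⊛ (m - 1ℤ) ≡ d ⊕ a ⊕ a ⊕ c - a ⊛ + 2 ⊕ c ⊛ (m - + 2)
    regroup = solve-∀

  rowSum-distinctColours : ∀ u v {a b} → a ≢ b →
                           Σℤ (fibreSum (common (u , a) (v , b))) ≡ A u v ⊛ + 2 ⊕ codegree u v ⊛ (+ m - + 2)
  rowSum-distinctColours u v {a} {b} a≢b = begin
    Σℤ (fibreSum (common (u , a) (v , b)))
      ≡⟨ Σ-cong (fibreSum-common-distinct u v a≢b) ⟩
    Σℤ (λ w → UK w ⊕ JV w ⊕ bothAdj u v w ⊛ (+ m - + 2))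
      ≡⟨ Σ-+ (λ w → UK w ⊕ JV w) (λ w → bothAdj u v w ⊛ (+ m - + 2)) ⟩
    Σℤ (λ w → UK w ⊕ JV w) ⊕ Σℤ (λ w → bothAdj u v w ⊛ (+ m - + 2))
      ≡⟨ cong₂ _⊕_ (trans (Σ-+ UK JV) (cong₂ _⊕_ (Σ-self∧ u (adj Γ v)) (Σ-∧self (adj Γ u) v)))
                   (Σ-*ʳ (+ m - + 2) (bothAdj u v)) ⟩
    A v u ⊕ A u v ⊕ codegree u v ⊛ (+ m - + 2)
      ≡⟨ cong (λ t → t ⊕ A u v ⊕ codegree u v ⊛ (+ m - + 2)) (cong b2z (Graph.sym Γ v u)) ⟩
    A u v ⊕ A u v ⊕ codegree u v ⊛ (+ m - + 2)
      ≡⟨ double (A u v) (codegree u v ⊛ (+ m - + 2)) ⟩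
    A u v ⊛ + 2 ⊕ codegree u v ⊛ (+ m - + 2) ∎
    where
    open ≡-Reasoning
    double : ∀ a c → a ⊕ a ⊕ c ≡ a ⊛ + 2 ⊕ c
    double = solve-∀
    UK JV : Fin n → ℤ
    UK w = b2z ((u ≟ᵇ w) ∧ adj Γ v w)
    JV w = b2z (adj Γ u w ∧ (v ≟ᵇ w))

  module _ (2∣m : 2 ∣ m) (2∣commonClosed : ∀ u v → 2 ∣ commonClosed Γ u v) where
    private
      2∣m-2 : + 2 ∣ᶻ + m - + 2
      2∣m-2 = ∣m∣n⇒∣m-n (2∣⇒2∣ᶻ 2∣m) ∣-refl

      evenPair : ∀ p q → + 2 ∣ᶻ Σℤ (fibreSum (common p q))
      evenPair (u , a) (v , b) with a ≟ b
      ... | yes refl = subst (+ 2 ∣ᶻ_) (sym (rowSum-sameColour-commonClosed u v a))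
                         (∣m∣n⇒∣m+n (∣m∣n⇒∣m-n (2∣⇒2∣ᶻ (2∣commonClosed u v)) (divides (A u v) refl))
                                    (∣n⇒∣m*n (codegree u v) 2∣m-2))
      ... | no a≢b   = subst (+ 2 ∣ᶻ_) (sym (rowSum-distinctColours u v a≢b))
                         (∣m∣n⇒∣m+n (divides (A u v) refl) (∣n⇒∣m*n (codegree u v) 2∣m-2))

    rowSums-even : ∀ r → EvenSum (RAmatrix Δ r)
    rowSums-even (inj₁ x)       =
      IsLattice.∈-resp-≗ EvenSum-isLattice (λ z → cong b2z (𝔹.∧-idem (inN Δ x z))) (rowSums-even (inj₂ (x , x)))
    rowSums-even (inj₂ (x , y)) = subst (+ 2 ∣ᶻ_) (sym (rowSum-common x y)) (evenPair (point x) (point y))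

  oddColourCount⇒oddRow : 2 ∣ suc m → ∀ v a → OddSum (RAmatrix Δ (inj₂ (flat (v , a) , flat (v , a))))
  oddColourCount⇒oddRow 2∣1+m v a = subst (+ 2 ∣ᶻ_) (sym (begin
    1ℤ ⊕ Σℤ (RAmatrix Δ (inj₂ (flat (v , a) , flat (v , a))))
      ≡⟨ cong (1ℤ ⊕_) (trans (rowSum-flat (v , a) (v , a)) (rowSum-sameColour v v a)) ⟩
    1ℤ ⊕ (δ v v ⊕ codegree v v ⊛ (+ m - 1ℤ))
      ≡⟨ cong (λ t → 1ℤ ⊕ (t ⊕ codegree v v ⊛ (+ m - 1ℤ))) (δ-refl v) ⟩
    1ℤ ⊕ (1ℤ ⊕ codegree v v ⊛ (+ m - 1ℤ))
      ≡⟨ regroup (codegree v v) (+ m) ⟩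
    + 2 ⊕ codegree v v ⊛ (1ℤ ⊕ + m - + 2) ∎))
    (∣m∣n⇒∣m+n ∣-refl (∣n⇒∣m*n (codegree v v) (∣m∣n⇒∣m-n (2∣⇒2∣ᶻ 2∣1+m) ∣-refl)))
    where
    open ≡-Reasoning
    regroup : ∀ c m → 1ℤ ⊕ (1ℤ ⊕ c ⊛ (m - 1ℤ)) ≡ + 2 ⊕ c ⊛ (1ℤ ⊕ m - + 2)
    regroup = solve-∀

  oddCommonClosed⇒oddRow : 2 ∣ m → ∀ {u v} → 2 ∣ suc (commonClosed Γ u v) → ∀ a →
                           OddSum (RAmatrix Δ (inj₂ (flat (u , a) , flat (v , a))))
  oddCommonClosed⇒oddRow 2∣m {u} {v} 2∣1+cc a = subst (+ 2 ∣ᶻ_) (sym (begin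
    1ℤ ⊕ Σℤ (RAmatrix Δ (inj₂ (flat (u , a) , flat (v , a))))
      ≡⟨ cong (1ℤ ⊕_) (trans (rowSum-flat (u , a) (v , a)) (rowSum-sameColour-commonClosed u v a)) ⟩
    1ℤ ⊕ (+ commonClosed Γ u v - A u v ⊛ + 2 ⊕ codegree u v ⊛ (+ m - + 2))
      ≡⟨ regroup (+ commonClosed Γ u v) (A u v) (codegree u v ⊛ (+ m - + 2)) ⟩
    1ℤ ⊕ + commonClosed Γ u v - A u v ⊛ + 2 ⊕ codegree u v ⊛ (+ m - + 2) ∎))
    (∣m∣n⇒∣m+n (∣m∣n⇒∣m-n (2∣⇒2∣ᶻ 2∣1+cc) (divides (A u v) refl))
               (∣n⇒∣m*n (codegree u v) (∣m∣n⇒∣m-n (2∣⇒2∣ᶻ 2∣m) ∣-refl)))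
    where
    open ≡-Reasoning
    regroup : ∀ c a x → 1ℤ ⊕ (c - a ⊛ + 2 ⊕ x) ≡ 1ℤ ⊕ c - a ⊛ + 2 ⊕ x
    regroup = solve-∀

  ParityCondition : Set
  ParityCondition = (2 ∣ m) × (∀ v → ¬ (2 ∣ deg Γ v)) × (∀ u v → 2 ∣ commonClosed Γ u v)

  parityCondition? : Dec ParityCondition
  parityCondition? = (2 ℕ.∣? m)
                 ×-dec all? (λ v → ¬? (2 ℕ.∣? deg Γ v))
                 ×-dec all? (λ u → all? (λ v → 2 ℕ.∣? commonClosed Γ u v))

  ¬parityCondition⇒oddRow : Fin n → Fin m → ¬ ParityCondition → ∃ λ r → OddSum (RAmatrix Δ r)
  ¬parityCondition⇒oddRow v₀ c₀ ¬cond with even⊎odd m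
  ... | inj₂ 2∣1+m = inj₂ (flat (v₀ , c₀) , flat (v₀ , c₀)) , oddColourCount⇒oddRow 2∣1+m v₀ c₀
  ... | inj₁ 2∣m with all? (λ u → all? (λ v → 2 ℕ.∣? commonClosed Γ u v))
  ...   | yes 2∣cc = contradiction (2∣m , (λ v → evenCommonClosed⇒oddDegree v (2∣cc v v)) , 2∣cc) ¬cond
  ...   | no ¬2∣cc with ¬∀⟶∃¬ n _ (λ u → all? (λ v → 2 ℕ.∣? commonClosed Γ u v)) ¬2∣cc
  ...     | u , ¬2∣ccᵤ with ¬∀⟶∃¬ n _ (λ v → 2 ℕ.∣? commonClosed Γ u v) ¬2∣ccᵤ
  ...       | v , ¬2∣ccᵤᵥ with even⊎odd (commonClosed Γ u v)
  ...         | inj₁ 2∣ccᵤᵥ  = contradiction 2∣ccᵤᵥ ¬2∣ccᵤᵥ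
  ...         | inj₂ 2∣1+cc = inj₂ (flat (u , c₀) , flat (v , c₀)) , oddCommonClosed⇒oddRow 2∣m {u} {v} 2∣1+cc c₀

mainTheorem12 : ∀ {n} (Γ : Graph n) (m : ℕ) → 3 ≤ m → Connected Γ → NonBipartite Γ →
    (IsKRA 2 (tensorK Γ m) ⊎ IsRA (tensorK Γ m))
    × (IsKRA 2 (tensorK Γ m) ⇔
        ((2 ∣ m) × (∀ v → ¬ (2 ∣ deg Γ v)) × (∀ u v → 2 ∣ commonClosed Γ u v)))
mainTheorem12 {zero}  Γ m _ _ nonBipartite = contradiction ((λ ()) , (λ ())) nonBipartite
mainTheorem12 {suc _} Γ m@(suc (suc (suc _))) (s≤s (s≤s (s≤s _))) connected nonBipartite = decide parityCondition?
  where
  open TensorK Γ m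
  differences∈ : ∀ x y → RowSpan Δ (λ z → δ x z - δ y z)
  differences∈ = difference∈RowSpan connected nonBipartite zero thirdColour
  doubleZero∈ : RowSpan Δ (λ z → + 2 ⊛ δ zero z)
  doubleZero∈ = double∈RowSpan connected nonBipartite zero thirdColour zero
  decide : Dec ParityCondition → (IsKRA 2 Δ ⊎ IsRA Δ) × (IsKRA 2 Δ ⇔ ParityCondition)
  decide (yes cond@(2∣m , _ , 2∣cc)) = inj₁ isKRA2 , mk⇔ (λ _ → cond) (λ _ → isKRA2)
    where
    isKRA2 : IsKRA 2 Δ
    isKRA2 = RowSpan⇔EvenSum⇒IsKRA2 Δ (λ x → mk⇔ (RowSpan-minimal Δ EvenSum-isLattice (rowSums-even 2∣m 2∣cc))
                                                    (evenSum⊆ (RowSpan-isLattice Δ) zero differences∈ doubleZero∈))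
  decide (no ¬cond) =
    inj₂ isRA , mk⇔ (λ isKRA2 → contradiction isRA (¬IsKRA2×IsRA Δ isKRA2)) (λ cond → contradiction cond ¬cond)
    where
    oddRow : ∃ λ r → OddSum (RAmatrix Δ r)
    oddRow = ¬parityCondition⇒oddRow zero zero ¬cond
    isRA : IsRA Δ
    isRA = oddSum⇒all (RowSpan-isLattice Δ) zero differences∈ doubleZero∈ (row∈RowSpan Δ (proj₁ oddRow)) (proj₂ oddRow)
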